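{- Let $q$ be a prime power, let $n\ge 2$ be an integer and let $f:\mathbb{F}_q\to\mathbb{F}_q$ be $f(x)=x^n$. For a positive integer $r$, let $\mathcal{P}(r,q)$ be the number of $r$-periodic points of $f$ and $\mathcal{C}(r,q)$ the number of $r$-cycles of $f$. Then $$\mathcal{P}(r,q)=\sum_{d\mid r}\mu(d)\big(\gcd(n^{r/d}-1,q-1)+1\big),\qquad \mathcal{C}(r,q)=\frac{\mathcal{P}(r,q)}{r}=\frac{1}{r}\sum_{d\mid r}\mu(d)\big(\gcd(n^{r/d}-1,q-1)+1\big).$$
   Context: $\mu$ denotes the Möbius function. $f^{\circ r}$ denotes the $r$-th iterate of $f$. A point $x_0$ is periodic if $f^{\circ r}(x_0)=x_0$ for some $r\ge1$; the least such $r$ is its period, and $x_0$ is then called an $r$-periodic point. An $r$-cycle is a set $\{x_0,\dots,x_{r-1}\}$ of $r$-periodic points with $x_j=f(x_{j-1})$ for $1\le j\le r-1$ and $x_0=f(x_{r-1})$. -}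

module Defs where

open import Level using (0ℓ)
open import Data.Nat as ℕ using (ℕ; zero; suc; _≤_; _<_)
open import Data.Nat.Divisibility using (_∣_; _∣?_)
open import Data.Nat.DivMod using (_/_)
open import Data.Nat.GCD using (gcd)
open import Data.Nat.Primality using (Prime; prime?)
open import Data.Integer as ℤ using (ℤ)
open import Data.Fin using (Fin; toℕ)
open import Data.Fin.Subset using (Subset; _∈_)
open import Data.Fin.Subset.Properties using (_∈?_)
open import Data.Fin.Properties using (any?; all?; _≟_)
open import Data.Vec using (_∷_; [])
open import Data.List using (List; []; _∷_; length; filter; map; upTo; allFin; foldr; _++_)
open import Data.Bool using (true; false)
open import Data.Product using (Σ; ∃; _×_; _,_)
open import Relation.Nullary using (¬_; Dec; yes; no)
open import Relation.Nullary.Decidable using (_×-dec_; _→-dec_; ¬?)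
open import Relation.Unary using (Pred; Decidable)
open import Relation.Binary.PropositionalEquality using (_≡_; _≢_)
open import Algebra.Core using (Op₁; Op₂)
open import Algebra.Structures using (IsCommutativeRing)

IsPrimePower : ℕ → Set
IsPrimePower q = Σ ℕ λ p → Σ ℕ λ k → Prime p × 1 ≤ k × q ≡ p ℕ.^ k

-- A finite field with q elements.  Every finite field of order q is
-- isomorphic to one whose carrier is Fin q, so we take Fin q as carrier
-- with propositional equality.

record FiniteField (q : ℕ) : Set where
  field
    _+_ _*_ : Op₂ (Fin q)
    -_      : Op₁ (Fin q)
    0# 1#   : Fin q
    isCommutativeRing : IsCommutativeRing _≡_ _+_ _*_ -_ 0# 1#
    0≢1     : 0# ≢ 1#
    inverse : ∀ x → x ≢ 0# → ∃ λ y → x * y ≡ 1#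

  _^_ : Fin q → ℕ → Fin q
  x ^ zero  = 1#
  x ^ suc n = x * (x ^ n)

iter : ∀ {A : Set} → (A → A) → ℕ → A → A
iter f zero    x = x
iter f (suc r) x = f (iter f r x)

module _ {q : ℕ} (f : Fin q → Fin q) where

  IsPeriodicPoint : ℕ → Fin q → Set
  IsPeriodicPoint r x =
    1 ≤ r × iter f r x ≡ x × (∀ (k : Fin r) → 1 ≤ toℕ k → iter f (toℕ k) x ≢ x)

  periodic? : ∀ r → Decidable (IsPeriodicPoint r)
  periodic? r x =
    (1 ℕ.≤? r) ×-dec (iter f r x ≟ x) ×-dec
    all? (λ k → (1 ℕ.≤? toℕ k) →-dec ¬? (iter f (toℕ k) x ≟ x))

  IsCycle : ℕ → Subset q → Set
  IsCycle r S = Σ (Fin q) λ x₀ → x₀ ∈ S × IsPeriodicPoint r x₀ ×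
    (∀ y → (y ∈ S → ∃ λ (j : Fin r) → iter f (toℕ j) x₀ ≡ y)
         × ((∃ λ (j : Fin r) → iter f (toℕ j) x₀ ≡ y) → y ∈ S))

  cycle? : ∀ r → Decidable (IsCycle r)
  cycle? r S = any? λ x₀ → (x₀ ∈? S) ×-dec periodic? r x₀ ×-dec
    all? (λ y → ((y ∈? S) →-dec any? (λ j → iter f (toℕ j) x₀ ≟ y))
         ×-dec (any? (λ j → iter f (toℕ j) x₀ ≟ y) →-dec (y ∈? S)))

allSubsets : ∀ n → List (Subset n)
allSubsets zero    = [] ∷ []
allSubsets (suc n) = map (false ∷_) (allSubsets n) ++ map (true ∷_) (allSubsets n)

numPeriodicPoints : ∀ {q} → (Fin q → Fin q) → ℕ → ℕ
numPeriodicPoints {q} f r = length (filter (periodic? f r) (allFin q))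

numCycles : ∀ {q} → (Fin q → Fin q) → ℕ → ℕ
numCycles {q} f r = length (filter (cycle? f r) (allSubsets q))

SquareFree : ℕ → Set
SquareFree d = ∀ (m : Fin (suc d)) → 2 ≤ toℕ m → ¬ (toℕ m ℕ.* toℕ m ∣ d)

squareFree? : ∀ d → Dec (SquareFree d)
squareFree? d = all? λ m → (2 ℕ.≤? toℕ m) →-dec ¬? (toℕ m ℕ.* toℕ m ∣? d)

numPrimeDivisors : ℕ → ℕ
numPrimeDivisors d = length (filter (λ p → prime? p ×-dec p ∣? d) (upTo (suc d)))

μ : ℕ → ℤ
μ d with squareFree? d
... | yes _ = (ℤ.- ℤ.1ℤ) ℤ.^ numPrimeDivisors d
... | no  _ = ℤ.0ℤ

periodicFormula : ℕ → ℕ → ℕ → ℤ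
periodicFormula n q r = foldr ℤ._+_ ℤ.0ℤ
  (map (λ k → μ (suc k) ℤ.* ℤ.+ (gcd (n ℕ.^ (r / suc k) ℕ.∸ 1) (q ℕ.∸ 1) ℕ.+ 1))
       (filter (λ k → suc k ∣? r) (upTo r)))

module Submission where

-- 1. Fixed points.  f^r(x) = x^(n^r), so f^r fixes x iff x = 0 or
--    x^(n^r - 1) = 1.  The equation x^m = 1 (m ≥ 1) has exactly
--    gcd(m, q - 1) solutions in F: x^d = 1 has at most d solutions because
--    a nonzero polynomial has at most its degree many roots, at least d
--    when d ∣ q - 1 by Fermat's little theorem and a fibre count, and
--    x^m = 1 iff x^gcd(m, q-1) = 1 by Bézout.  So #Fix(f^r) = gcd(n^r - 1, q - 1) + 1.
-- 2. For any self-map, Fix(f^r) is the disjoint union over d ∣ r of the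
--    d-periodic points, so #Fix(f^r) = Σ_{d ∣ r} P(d).
-- 3. Möbius inversion, from Σ_{d ∣ m} μ(d) = [m = 1], then yields P(r).
-- 4. Every r-periodic point lies in exactly one r-cycle, its orbit, and
--    every r-cycle has r points; double counting gives r C(r) = P(r).

open import Defs
open import Data.Nat using (ℕ; _≤_)
open import Data.Fin using (Fin)

module Counting where
  open import Defs using (allSubsets)
  open import Data.Bool as Bool using (Bool; true; false)
  open import Data.Fin.Subset using (Subset)
  open import Data.Vec using ([]; _∷_)
  import Data.Vec.Properties as Vec
  open import Relation.Binary.Definitions using (DecidableEquality)
  open import Data.Nat using (ℕ; zero; suc; _+_; _*_; _≤_)
  open import Data.Nat.Properties using (+-0-commutativeMonoid; +-*-semiring; +-mono-≤; ≤-refl; +-assoc; *-zeroʳ; *-identityʳ; *-distribˡ-+)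
  open import Data.Fin using (Fin; zero; suc)
  import Data.Fin.Properties as Fin
  open import Data.List using (List; []; _∷_; _++_; map; length; filter; tabulate; allFin)
  open import Relation.Nullary using (Dec; yes; no; ¬_)
  open import Relation.Nullary.Decidable using (_×-dec_)
  open import Relation.Unary using (Pred; Decidable)
  open import Relation.Binary.PropositionalEquality
  open import Data.Empty using (⊥-elim)
  open import Data.Product using (_,_)
  open import Function using (_∘_)

  open import Algebra.Properties.CommutativeMonoid.Sum +-0-commutativeMonoid public
    using (sum; sum-syntax; sum-cong-≗; sum-replicate-zero; ∑-distrib-+; ∑-comm; sum-permute)
  open import Algebra.Properties.Semiring.Sum +-*-semiring public
    using (*-distribˡ-sum)

  χ : ∀ {p} {P : Set p} → Dec P → ℕ
  χ (yes _) = 1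
  χ (no _)  = 0

  χ-yes : ∀ {p} {P : Set p} (d : Dec P) → P → χ d ≡ 1
  χ-yes (yes _) _ = refl
  χ-yes (no ¬p) p = ⊥-elim (¬p p)

  χ-no : ∀ {p} {P : Set p} (d : Dec P) → ¬ P → χ d ≡ 0
  χ-no (yes p) ¬p = ⊥-elim (¬p p)
  χ-no (no _) _   = refl

  χ-⇔ : ∀ {p r} {P : Set p} {R : Set r} (d : Dec P) (e : Dec R) → (P → R) → (R → P) → χ d ≡ χ e
  χ-⇔ (yes _) (yes _) _ _ = refl
  χ-⇔ (yes p) (no ¬r) f _ = ⊥-elim (¬r (f p))
  χ-⇔ (no ¬p) (yes r) _ g = ⊥-elim (¬p (g r))
  χ-⇔ (no _)  (no _)  _ _ = refl

  χ-× : ∀ {p r} {P : Set p} {R : Set r} (d : Dec P) (e : Dec R) → χ d * χ e ≡ χ (d ×-dec e)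
  χ-× (yes _) (yes _) = refl
  χ-× (yes _) (no _)  = refl
  χ-× (no _)  _       = refl

  sum-zero : ∀ {n} (f : Fin n → ℕ) → (∀ i → f i ≡ 0) → sum f ≡ 0
  sum-zero {n} f f≗0 = trans (sum-cong-≗ f≗0) (sum-replicate-zero n)

  sum-mono : ∀ {n} {f g : Fin n → ℕ} → (∀ i → f i ≤ g i) → sum f ≤ sum g
  sum-mono {zero}  _   = ≤-refl
  sum-mono {suc n} f≤g = +-mono-≤ (f≤g zero) (sum-mono (f≤g ∘ suc))

  count : ∀ {n p} {P : Pred (Fin n) p} → Decidable P → ℕ
  count {n} P? = ∑[ i < n ] χ (P? i)

  length-filter-tabulate : ∀ {a p} {A : Set a} {P : Pred A p} (P? : Decidable P) {n} (g : Fin n → A) →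
    length (filter P? (tabulate g)) ≡ ∑[ i < n ] χ (P? (g i))
  length-filter-tabulate P? {zero}  g = refl
  length-filter-tabulate P? {suc n} g with P? (g zero)
  ... | yes _ = cong suc (length-filter-tabulate P? (g ∘ suc))
  ... | no _  = length-filter-tabulate P? (g ∘ suc)

  length-filter-allFin : ∀ {n p} {P : Pred (Fin n) p} (P? : Decidable P) → length (filter P? (allFin n)) ≡ count P?
  length-filter-allFin P? = length-filter-tabulate P? (λ i → i)

  count-singleton : ∀ {n} (j : Fin n) → count (j Fin.≟_) ≡ 1
  count-singleton {suc n} zero = cong suc (sum-zero {n} _ (λ i → χ-no (zero Fin.≟ suc i) (λ ())))
  count-singleton {suc n} (suc j) = trans (sum-cong-≗ shift) (count-singleton j)
    where
    shift : ∀ i → χ (suc j Fin.≟ suc i) ≡ χ (j Fin.≟ i)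
    shift i = χ-⇔ (suc j Fin.≟ suc i) (j Fin.≟ i) Fin.suc-injective (cong suc)

  sum-ones : ∀ n → ∑[ i < n ] 1 ≡ n
  sum-ones zero    = refl
  sum-ones (suc n) = cong suc (sum-ones n)

  sum-select : ∀ {n} (g : Fin n → ℕ) (j : Fin n) → ∑[ i < n ] (g i * χ (j Fin.≟ i)) ≡ g j
  sum-select {n} g j = begin
    ∑[ i < n ] (g i * χ (j Fin.≟ i))  ≡⟨ sum-cong-≗ only-j ⟩
    ∑[ i < n ] (g j * χ (j Fin.≟ i))  ≡⟨ sym (*-distribˡ-sum (g j) (λ i → χ (j Fin.≟ i))) ⟩
    g j * count (j Fin.≟_)             ≡⟨ cong (g j *_) (count-singleton j) ⟩
    g j * 1                            ≡⟨ *-identityʳ (g j) ⟩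
    g j                                ∎
    where
    open ≡-Reasoning
    only-j : ∀ i → g i * χ (j Fin.≟ i) ≡ g j * χ (j Fin.≟ i)
    only-j i with j Fin.≟ i
    ... | yes refl = refl
    ... | no _     = trans (*-zeroʳ (g i)) (sym (*-zeroʳ (g j)))

  count-image : ∀ {r n} (g : Fin r → Fin n) → (∀ i j → g i ≡ g j → i ≡ j) →
    count (λ y → Fin.any? (λ i → g i Fin.≟ y)) ≡ r
  count-image {zero}  g _   = sum-zero _ (λ y → χ-no (Fin.any? (λ i → g i Fin.≟ y)) (λ { (() , _) }))
  count-image {suc r} {n} g injective = begin
    count (λ y → Fin.any? (λ i → g i Fin.≟ y))                             ≡⟨ sum-cong-≗ split ⟩
    ∑[ y < n ] (χ (g zero Fin.≟ y) + χ (Fin.any? (λ i → g (suc i) Fin.≟ y))) ≡⟨ ∑-distrib-+ (λ y → χ (g zero Fin.≟ y)) _ ⟩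
    count (g zero Fin.≟_) + count (λ y → Fin.any? (λ i → g (suc i) Fin.≟ y)) ≡⟨ cong₂ _+_ (count-singleton (g zero)) rest ⟩
    suc r                                                                   ∎
    where
    open ≡-Reasoning
    rest = count-image (g ∘ suc) (λ i j e → Fin.suc-injective (injective (suc i) (suc j) e))
    split : ∀ y → χ (Fin.any? (λ i → g i Fin.≟ y)) ≡ χ (g zero Fin.≟ y) + χ (Fin.any? (λ i → g (suc i) Fin.≟ y))
    split y with g zero Fin.≟ y | Fin.any? (λ i → g (suc i) Fin.≟ y)
    ... | yes g₀≡y | yes (i , gᵢ≡y) = ⊥-elim (Fin.0≢1+n (injective zero (suc i) (trans g₀≡y (sym gᵢ≡y))))
    ... | yes _    | no _  = refl
    ... | no _     | yes _ = refl
    ... | no _     | no _  = refl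

  listSum : ∀ {a} {A : Set a} → List A → (A → ℕ) → ℕ
  listSum []       h = 0
  listSum (x ∷ xs) h = h x + listSum xs h

  listSum-++ : ∀ {a} {A : Set a} (xs ys : List A) h → listSum (xs ++ ys) h ≡ listSum xs h + listSum ys h
  listSum-++ []       ys h = refl
  listSum-++ (x ∷ xs) ys h = trans (cong (h x +_) (listSum-++ xs ys h)) (sym (+-assoc (h x) _ _))

  listSum-map : ∀ {a b} {A : Set a} {B : Set b} (g : A → B) xs h → listSum (map g xs) h ≡ listSum xs (h ∘ g)
  listSum-map g []       h = refl
  listSum-map g (x ∷ xs) h = cong (h (g x) +_) (listSum-map g xs h)

  listSum-cong : ∀ {a} {A : Set a} (xs : List A) {h k : A → ℕ} → (∀ x → h x ≡ k x) → listSum xs h ≡ listSum xs k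
  listSum-cong []       _   = refl
  listSum-cong (x ∷ xs) h≗k = cong₂ _+_ (h≗k x) (listSum-cong xs h≗k)

  listSum-*ˡ : ∀ {a} {A : Set a} (xs : List A) c (h : A → ℕ) → listSum xs (λ x → c * h x) ≡ c * listSum xs h
  listSum-*ˡ []       c h = sym (*-zeroʳ c)
  listSum-*ˡ (x ∷ xs) c h = trans (cong (c * h x +_) (listSum-*ˡ xs c h)) (sym (*-distribˡ-+ c (h x) _))

  listSum-∑ : ∀ {a} {A : Set a} (xs : List A) {n} (h : A → Fin n → ℕ) →
    listSum xs (λ x → ∑[ i < n ] h x i) ≡ ∑[ i < n ] listSum xs (λ x → h x i)
  listSum-∑ []       {n} h = sym (sum-zero {n} _ (λ _ → refl))
  listSum-∑ (x ∷ xs) {n} h = trans (cong (sum (h x) +_) (listSum-∑ xs h)) (sym (∑-distrib-+ (h x) _))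

  length-filter : ∀ {a p} {A : Set a} {P : Pred A p} (P? : Decidable P) xs → length (filter P? xs) ≡ listSum xs (χ ∘ P?)
  length-filter P? []       = refl
  length-filter P? (x ∷ xs) with P? x
  ... | yes _ = cong suc (length-filter P? xs)
  ... | no _  = length-filter P? xs

  _≟ₛ_ : ∀ {n} → DecidableEquality (Subset n)
  _≟ₛ_ = Vec.≡-dec Bool._≟_

  allSubsets-once : ∀ n (T : Subset n) → listSum (allSubsets n) (λ S → χ (S ≟ₛ T)) ≡ 1
  allSubsets-once zero    []      = refl
  allSubsets-once (suc n) (b ∷ T) = begin
    listSum (map (false ∷_) Ss ++ map (true ∷_) Ss) (λ S → χ (S ≟ₛ (b ∷ T)))  ≡⟨ listSum-++ (map (false ∷_) Ss) _ _ ⟩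
    listSum (map (false ∷_) Ss) _ + listSum (map (true ∷_) Ss) _              ≡⟨ cong₂ _+_ (listSum-map _ Ss _) (listSum-map _ Ss _) ⟩
    with-head false + with-head true                                          ≡⟨ one-head with-head b same-head other-head ⟩
    1                                                                         ∎
    where
    open ≡-Reasoning
    Ss = allSubsets n
    with-head : Bool → ℕ
    with-head a = listSum Ss (λ S → χ ((a ∷ S) ≟ₛ (b ∷ T)))
    same-head : with-head b ≡ 1
    same-head = trans (listSum-cong Ss (λ S → χ-⇔ _ (S ≟ₛ T) Vec.∷-injectiveʳ (cong (b ∷_)))) (allSubsets-once n T)
    other-head : ∀ a → a ≢ b → with-head a ≡ 0
    other-head a a≢b = trans (listSum-cong Ss (λ S → χ-no ((a ∷ S) ≟ₛ (b ∷ T)) (a≢b ∘ Vec.∷-injectiveˡ))) (zeros Ss)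
      where
      zeros : ∀ (xs : List (Subset n)) → listSum xs (λ _ → 0) ≡ 0
      zeros []       = refl
      zeros (_ ∷ xs) = zeros xs
    one-head : ∀ (h : Bool → ℕ) c → h c ≡ 1 → (∀ a → a ≢ c → h a ≡ 0) → h false + h true ≡ 1
    one-head h false h[c]≡1 h≡0 = cong₂ _+_ h[c]≡1 (h≡0 true (λ ()))
    one-head h true  h[c]≡1 h≡0 = cong₂ _+_ (h≡0 false (λ ())) h[c]≡1

module FieldArithmetic {q : ℕ} (F : FiniteField q) where
  open import Data.Nat as ℕ using (ℕ; zero; suc)
  import Data.Nat.Properties as ℕ
  import Data.Fin.Properties as Fin
  import Data.Fin.Permutation as Perm
  open import Data.Sum using (_⊎_; inj₁; inj₂)
  open import Data.Product using (_,_; proj₁; proj₂)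
  open import Relation.Nullary using (yes; no)
  open import Relation.Binary.PropositionalEquality
  open import Algebra.Bundles using (CommutativeRing)

  open FiniteField F public using (_^_; 0≢1; inverse)
  ring : CommutativeRing _ _
  ring = record { isCommutativeRing = FiniteField.isCommutativeRing F }
  open CommutativeRing ring public
    using (Carrier; _+_; _*_; -_; 0#; 1#; +-assoc; +-comm; +-identityˡ; +-identityʳ; -‿inverseˡ; -‿inverseʳ;
           *-assoc; *-comm; *-identityˡ; *-identityʳ; zeroˡ; zeroʳ; distribˡ; distribʳ; *-commutativeMonoid)
  open ≡-Reasoning

  ^-+ : ∀ x a b → x ^ (a ℕ.+ b) ≡ x ^ a * x ^ b
  ^-+ x zero    b = sym (*-identityˡ _)
  ^-+ x (suc a) b = trans (cong (x *_) (^-+ x a b)) (sym (*-assoc x _ _))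

  ^-* : ∀ x a b → x ^ (a ℕ.* b) ≡ (x ^ a) ^ b
  ^-* x a zero    = cong (x ^_) (ℕ.*-zeroʳ a)
  ^-* x a (suc b) = begin
    x ^ (a ℕ.* suc b)      ≡⟨ cong (x ^_) (ℕ.*-suc a b) ⟩
    x ^ (a ℕ.+ a ℕ.* b)    ≡⟨ ^-+ x a _ ⟩
    x ^ a * x ^ (a ℕ.* b)  ≡⟨ cong (x ^ a *_) (^-* x a b) ⟩
    x ^ a * (x ^ a) ^ b    ∎

  *-^ : ∀ x y a → (x * y) ^ a ≡ x ^ a * y ^ a
  *-^ x y zero    = sym (*-identityˡ _)
  *-^ x y (suc a) = begin
    (x * y) * (x * y) ^ a       ≡⟨ cong ((x * y) *_) (*-^ x y a) ⟩
    (x * y) * (x ^ a * y ^ a)   ≡⟨ *-assoc x y _ ⟩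
    x * (y * (x ^ a * y ^ a))   ≡⟨ cong (x *_) (sym (*-assoc y _ _)) ⟩
    x * ((y * x ^ a) * y ^ a)   ≡⟨ cong (λ t → x * (t * y ^ a)) (*-comm y _) ⟩
    x * ((x ^ a * y) * y ^ a)   ≡⟨ cong (x *_) (*-assoc _ y _) ⟩
    x * (x ^ a * (y * y ^ a))   ≡⟨ sym (*-assoc x _ _) ⟩
    (x * x ^ a) * (y * y ^ a)   ∎

  1^ : ∀ a → 1# ^ a ≡ 1#
  1^ zero    = refl
  1^ (suc a) = trans (*-identityˡ _) (1^ a)

  0^ : ∀ a → 1 ℕ.≤ a → 0# ^ a ≡ 0#
  0^ (suc a) _ = zeroˡ _

  ^-one : ∀ x k t → x ^ k ≡ 1# → x ^ (t ℕ.* k) ≡ 1#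
  ^-one x k t xᵏ≡1 = begin
    x ^ (t ℕ.* k)  ≡⟨ cong (x ^_) (ℕ.*-comm t k) ⟩
    x ^ (k ℕ.* t)  ≡⟨ ^-* x k t ⟩
    (x ^ k) ^ t    ≡⟨ cong (_^ t) xᵏ≡1 ⟩
    1# ^ t         ≡⟨ 1^ t ⟩
    1#             ∎

  root-of-unity≢0 : ∀ {x} a → 1 ℕ.≤ a → x ^ a ≡ 1# → x ≢ 0#
  root-of-unity≢0 {x} a a≥1 xᵃ≡1 refl = 0≢1 (trans (sym (0^ a a≥1)) xᵃ≡1)

  cancelˡ : ∀ {x y z} → x ≢ 0# → x * y ≡ x * z → y ≡ z
  cancelˡ {x} {y} {z} x≢0 xy≡xz with inverse x x≢0
  ... | x⁻¹ , xx⁻¹≡1 = begin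
    y                ≡⟨ sym (*-identityˡ y) ⟩
    1# * y           ≡⟨ cong (_* y) (sym x⁻¹x≡1) ⟩
    (x⁻¹ * x) * y    ≡⟨ *-assoc x⁻¹ x y ⟩
    x⁻¹ * (x * y)    ≡⟨ cong (x⁻¹ *_) xy≡xz ⟩
    x⁻¹ * (x * z)    ≡⟨ sym (*-assoc x⁻¹ x z) ⟩
    (x⁻¹ * x) * z    ≡⟨ cong (_* z) x⁻¹x≡1 ⟩
    1# * z           ≡⟨ *-identityˡ z ⟩
    z                ∎
    where
    x⁻¹x≡1 : x⁻¹ * x ≡ 1#
    x⁻¹x≡1 = trans (*-comm x⁻¹ x) xx⁻¹≡1

  zero-product : ∀ x y → x * y ≡ 0# → x ≡ 0# ⊎ y ≡ 0#
  zero-product x y xy≡0 with x Fin.≟ 0#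
  ... | yes x≡0 = inj₁ x≡0
  ... | no x≢0  = inj₂ (cancelˡ x≢0 (trans xy≡0 (sym (zeroʳ x))))

  *-≢0 : ∀ {x y} → x ≢ 0# → y ≢ 0# → x * y ≢ 0#
  *-≢0 {x} {y} x≢0 y≢0 xy≡0 with zero-product x y xy≡0
  ... | inj₁ x≡0 = x≢0 x≡0
  ... | inj₂ y≡0 = y≢0 y≡0

  scaling : ∀ {x} → x ≢ 0# → Perm.Permutation q q
  scaling {x} x≢0 = Perm.permutation (x *_) (x⁻¹ *_) (undo xx⁻¹≡1) (undo (trans (*-comm x⁻¹ x) xx⁻¹≡1))
    where
    x⁻¹ = proj₁ (inverse x x≢0)
    xx⁻¹≡1 = proj₂ (inverse x x≢0)
    undo : ∀ {a b} → a * b ≡ 1# → ∀ y → a * (b * y) ≡ y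
    undo {a} {b} ab≡1 y = trans (sym (*-assoc a b y)) (trans (cong (_* y) ab≡1) (*-identityˡ y))

-- A nonzero polynomial over a field has at most as many roots as its
-- degree.  Polynomials are coefficient lists, lowest degree first.
module Polynomials {q : ℕ} (F : FiniteField q) where
  open import Data.Nat as ℕ using (ℕ; zero; suc; _∸_)
  import Data.Nat.Properties as ℕ
  open import Data.List using (List; []; _∷_; length)
  open import Data.List.Relation.Unary.All using (All; []; _∷_)
  open import Data.List.Relation.Unary.Unique.Propositional using (Unique; []; _∷_)
  open import Data.Sum using (inj₁; inj₂)
  open import Data.Empty using (⊥-elim)
  open import Relation.Binary.PropositionalEquality
  open FieldArithmetic F
  open ≡-Reasoning

  eval : List Carrier → Carrier → Carrier
  eval []       x = 0#
  eval (c ∷ cs) x = c + x * eval cs x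

  quotient : Carrier → List Carrier → List Carrier
  quotient a []           = []
  quotient a (c ∷ [])     = []
  quotient a (c ∷ c′ ∷ cs) = eval (c′ ∷ cs) a ∷ quotient a (c′ ∷ cs)

  length-quotient : ∀ a P → length (quotient a P) ≡ length P ∸ 1
  length-quotient a []            = refl
  length-quotient a (c ∷ [])      = refl
  length-quotient a (c ∷ c′ ∷ cs) = cong suc (length-quotient a (c′ ∷ cs))

  x-a+a : ∀ x a → x + - a + a ≡ x
  x-a+a x a = trans (+-assoc x (- a) a) (trans (cong (x +_) (-‿inverseˡ a)) (+-identityʳ x))

  division-step : ∀ x a c r Q → c + x * ((x + - a) * Q + r) ≡ (x + - a) * (r + x * Q) + (c + a * r)
  division-step x a c r Q = begin
    c + x * (d * Q + r)              ≡⟨ cong (c +_) (distribˡ x (d * Q) r) ⟩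
    c + (x * (d * Q) + x * r)        ≡⟨ cong₂ (λ s t → c + (s + t)) x[dQ]≡d[xQ] xr≡dr+ar ⟩
    c + (d * (x * Q) + (d * r + a * r)) ≡⟨ cong (c +_) (sym (+-assoc _ _ _)) ⟩
    c + ((d * (x * Q) + d * r) + a * r) ≡⟨ cong (λ t → c + (t + a * r)) (trans (+-comm _ _) (sym (distribˡ d r (x * Q)))) ⟩
    c + (d * (r + x * Q) + a * r)    ≡⟨ sym (+-assoc c _ _) ⟩
    (c + d * (r + x * Q)) + a * r    ≡⟨ cong (_+ a * r) (+-comm c _) ⟩
    (d * (r + x * Q) + c) + a * r    ≡⟨ +-assoc _ c _ ⟩
    d * (r + x * Q) + (c + a * r)    ∎
    where
    d = x + - a
    x[dQ]≡d[xQ] : x * (d * Q) ≡ d * (x * Q)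
    x[dQ]≡d[xQ] = trans (sym (*-assoc x d Q)) (trans (cong (_* Q) (*-comm x d)) (*-assoc d x Q))
    xr≡dr+ar : x * r ≡ d * r + a * r
    xr≡dr+ar = trans (cong (_* r) (sym (x-a+a x a))) (distribʳ r d a)

  division : ∀ a P x → eval P x ≡ (x + - a) * eval (quotient a P) x + eval P a
  division a [] x = sym (trans (+-identityʳ _) (zeroʳ _))
  division a (c ∷ []) x = begin
    c + x * 0#                     ≡⟨ trans (cong (c +_) (zeroʳ x)) (+-identityʳ c) ⟩
    c                              ≡⟨ sym (trans (cong₂ _+_ (zeroʳ _) (trans (cong (c +_) (zeroʳ a)) (+-identityʳ c))) (+-identityˡ c)) ⟩
    (x + - a) * 0# + (c + a * 0#)  ∎
  division a (c ∷ c′ ∷ cs) x = trans (cong (λ t → c + x * t) (division a (c′ ∷ cs) x))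
    (division-step x a c (eval (c′ ∷ cs) a) (eval (quotient a (c′ ∷ cs)) x))

  zero-from-quotient : ∀ a P → All (_≡ 0#) (quotient a P) → eval P a ≡ 0# → All (_≡ 0#) P
  zero-from-quotient a [] _ _ = []
  zero-from-quotient a (c ∷ []) _ Pa≡0 = trans (sym (trans (cong (c +_) (zeroʳ a)) (+-identityʳ c))) Pa≡0 ∷ []
  zero-from-quotient a (c ∷ c′ ∷ cs) (r≡0 ∷ Q≡0) Pa≡0 =
    trans (sym (trans (cong (λ t → c + a * t) r≡0) (trans (cong (c +_) (zeroʳ a)) (+-identityʳ c)))) Pa≡0
    ∷ zero-from-quotient a (c′ ∷ cs) Q≡0 r≡0

  root-of-quotient : ∀ a P b → a ≢ b → eval P a ≡ 0# → eval P b ≡ 0# → eval (quotient a P) b ≡ 0#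
  root-of-quotient a P b a≢b Pa≡0 Pb≡0 with zero-product (b + - a) (eval (quotient a P) b) factored
    where
    factored : (b + - a) * eval (quotient a P) b ≡ 0#
    factored = begin
      (b + - a) * eval (quotient a P) b          ≡⟨ sym (+-identityʳ _) ⟩
      (b + - a) * eval (quotient a P) b + 0#     ≡⟨ cong ((b + - a) * eval (quotient a P) b +_) (sym Pa≡0) ⟩
      (b + - a) * eval (quotient a P) b + eval P a ≡⟨ sym (division a P b) ⟩
      eval P b                                   ≡⟨ Pb≡0 ⟩
      0#                                         ∎
  ... | inj₁ b-a≡0 = ⊥-elim (a≢b (sym (trans (sym (x-a+a b a)) (trans (cong (_+ a) b-a≡0) (+-identityˡ a)))))
  ... | inj₂ Qb≡0  = Qb≡0

  few-roots : ∀ (roots : List Carrier) → Unique roots → ∀ P → length P ℕ.≤ length roots →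
    All (λ r → eval P r ≡ 0#) roots → All (_≡ 0#) P
  few-roots []       _           [] _ _ = []
  few-roots (a ∷ as) (a∉as ∷ as!) P |P|≤ (Pa≡0 ∷ Pas≡0) =
    zero-from-quotient a P (few-roots as as! (quotient a P) |Q|≤ (quotient-roots a∉as Pas≡0)) Pa≡0
    where
    |Q|≤ : length (quotient a P) ℕ.≤ length as
    |Q|≤ = subst (ℕ._≤ length as) (sym (length-quotient a P)) (ℕ.∸-monoˡ-≤ 1 |P|≤)
    quotient-roots : ∀ {bs} → All (a ≢_) bs → All (λ r → eval P r ≡ 0#) bs → All (λ r → eval (quotient a P) r ≡ 0#) bs
    quotient-roots []             []             = []
    quotient-roots (a≢b ∷ a≢bs) (Pb≡0 ∷ Pbs≡0) = root-of-quotient a P _ a≢b Pa≡0 Pb≡0 ∷ quotient-roots a≢bs Pbs≡0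

module RootsOfUnity {q : ℕ} (F : FiniteField q) where
  open import Data.Nat as ℕ using (ℕ; suc; _∸_; z≤n; s≤s)
  import Data.Nat.Properties as ℕ
  open import Data.Nat.GCD using (gcd; gcd-GCD; gcd[m,n]∣m; gcd[m,n]∣n; gcd[m,n]≡0⇒m≡0; module Bézout)
  open import Data.Nat.Divisibility using (_∣_)
  open import Data.Fin using (Fin; zero)
  import Data.Fin.Properties as Fin
  open import Data.List as List using (List; _∷_; filter; allFin)
  import Data.List.Relation.Unary.All as All
  import Data.List.Relation.Unary.All.Properties as All
  import Data.List.Relation.Unary.Unique.Propositional.Properties as Unique
  open import Data.Product using (_,_)
  open import Data.Empty using (⊥-elim)
  open import Relation.Nullary using (Dec; yes; no; ¬_)
  open import Relation.Nullary.Decidable using (¬?)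
  open import Relation.Binary.PropositionalEquality
  open Counting
  open FieldArithmetic F
  open Polynomials F using (eval; few-roots)
  open import Algebra.Properties.CommutativeMonoid.Sum *-commutativeMonoid
    using () renaming (sum to ∏; sum-cong-≗ to ∏-cong-≗; ∑-distrib-+ to ∏-distrib-*; sum-permute to ∏-permute)

  #roots : ℕ → ℕ
  #roots m = count (λ x → x ^ m Fin.≟ 1#)

  nonzero? : ∀ y → Dec (y ≢ 0#)
  nonzero? y = ¬? (y Fin.≟ 0#)

  count-zero : count (Fin._≟ 0#) ≡ 1
  count-zero = trans (sum-cong-≗ (λ y → χ-⇔ (y Fin.≟ 0#) (0# Fin.≟ y) sym sym)) (count-singleton 0#)

  count-nonzero : count nonzero? ≡ q ∸ 1
  count-nonzero = begin
    count nonzero?                                ≡⟨ sym (ℕ.m+n∸n≡m _ 1) ⟩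
    count nonzero? ℕ.+ 1 ∸ 1                      ≡⟨ cong (λ t → count nonzero? ℕ.+ t ∸ 1) (sym count-zero) ⟩
    count nonzero? ℕ.+ count (Fin._≟ 0#) ∸ 1      ≡⟨ cong (_∸ 1) (sym (∑-distrib-+ (λ y → χ (nonzero? y)) (λ y → χ (y Fin.≟ 0#)))) ⟩
    ∑[ y < q ] (χ (nonzero? y) ℕ.+ χ (y Fin.≟ 0#)) ∸ 1 ≡⟨ cong (_∸ 1) (trans (sum-cong-≗ one) (sum-ones q)) ⟩
    q ∸ 1                                         ∎
    where
    open ≡-Reasoning
    one : ∀ y → χ (nonzero? y) ℕ.+ χ (y Fin.≟ 0#) ≡ 1
    one y with y Fin.≟ 0#
    ... | yes _ = refl
    ... | no _  = refl

  q≥2 : 2 ℕ.≤ q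
  q≥2 = distinct⇒≥2 0# 1# 0≢1
    where
    distinct⇒≥2 : ∀ {n} (a b : Fin n) → a ≢ b → 2 ℕ.≤ n
    distinct⇒≥2 {suc ℕ.zero} zero zero a≢b = ⊥-elim (a≢b refl)
    distinct⇒≥2 {suc (suc n)} _ _ _ = s≤s (s≤s z≤n)

  -- Replacing 0 by 1 turns every element into a unit; the product of
  -- these units is the product of all nonzero elements.
  unit : Carrier → Carrier
  unit y with y Fin.≟ 0#
  ... | yes _ = 1#
  ... | no _  = y

  unit≢0 : ∀ y → unit y ≢ 0#
  unit≢0 y with y Fin.≟ 0#
  ... | yes _   = λ 1≡0 → 0≢1 (sym 1≡0)
  ... | no y≢0  = y≢0

  unit-scale : ∀ {x} → x ≢ 0# → ∀ y → unit (x * y) ≡ x ^ χ (nonzero? y) * unit y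
  unit-scale {x} x≢0 y with y Fin.≟ 0#
  ... | yes refl with x * 0# Fin.≟ 0#
  ...   | yes _   = sym (*-identityˡ 1#)
  ...   | no x0≢0 = ⊥-elim (x0≢0 (zeroʳ x))
  unit-scale {x} x≢0 y | no y≢0 with x * y Fin.≟ 0#
  ...   | yes xy≡0 = ⊥-elim (*-≢0 x≢0 y≢0 xy≡0)
  ...   | no _     = cong (_* y) (sym (*-identityʳ x))

  ∏-^ : ∀ {n} x (e : Fin n → ℕ) → ∏ (λ i → x ^ e i) ≡ x ^ (∑[ i < n ] e i)
  ∏-^ {ℕ.zero} x e = refl
  ∏-^ {suc n}  x e = trans (cong (x ^ e zero *_) (∏-^ x (λ i → e (Fin.suc i)))) (sym (^-+ x (e zero) _))

  ∏-≢0 : ∀ {n} (g : Fin n → Carrier) → (∀ i → g i ≢ 0#) → ∏ g ≢ 0#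
  ∏-≢0 {ℕ.zero} g _   ∏≡0 = 0≢1 (sym ∏≡0)
  ∏-≢0 {suc n}  g g≢0 = *-≢0 (g≢0 zero) (∏-≢0 (λ i → g (Fin.suc i)) (λ i → g≢0 (Fin.suc i)))

  -- Fermat's little theorem for finite fields: compare the product of all
  -- units before and after the permutation y ↦ x y.
  fermat : ∀ x → x ≢ 0# → x ^ (q ∸ 1) ≡ 1#
  fermat x x≢0 = sym (cancelˡ (∏-≢0 unit unit≢0) (begin
    U * 1#                                  ≡⟨ *-identityʳ U ⟩
    U                                       ≡⟨ ∏-permute unit (scaling x≢0) ⟩
    ∏ (λ y → unit (x * y))                  ≡⟨ ∏-cong-≗ (unit-scale x≢0) ⟩
    ∏ (λ y → x ^ χ (nonzero? y) * unit y)   ≡⟨ ∏-distrib-* (λ y → x ^ χ (nonzero? y)) unit ⟩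
    ∏ (λ y → x ^ χ (nonzero? y)) * U        ≡⟨ cong (_* U) (∏-^ x (λ y → χ (nonzero? y))) ⟩
    x ^ count nonzero? * U                  ≡⟨ cong (λ t → x ^ t * U) count-nonzero ⟩
    x ^ (q ∸ 1) * U                         ≡⟨ *-comm _ U ⟩
    U * x ^ (q ∸ 1)                         ∎))
    where
    open ≡-Reasoning
    U = ∏ unit

  roots-upper : ∀ d → #roots (suc d) ℕ.≤ suc d
  roots-upper d = ℕ.≮⇒≥ too-many
    where
    roots = filter (λ x → x ^ suc d Fin.≟ 1#) (allFin q)
    -- the coefficient list X^d, and X^(d+1) - 1 = -1 + X · X^d
    monomial : ℕ → List Carrier
    monomial ℕ.zero = 1# ∷ List.[]
    monomial (suc k) = 0# ∷ monomial k
    eval-monomial : ∀ k x → eval (monomial k) x ≡ x ^ k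
    eval-monomial ℕ.zero  x = trans (cong (1# +_) (zeroʳ x)) (+-identityʳ 1#)
    eval-monomial (suc k) x = trans (+-identityˡ _) (cong (x *_) (eval-monomial k x))
    length-monomial : ∀ k → List.length (monomial k) ≡ suc k
    length-monomial ℕ.zero  = refl
    length-monomial (suc k) = cong suc (length-monomial k)
    P = - 1# ∷ monomial d
    P-root : ∀ {x} → x ^ suc d ≡ 1# → eval P x ≡ 0#
    P-root {x} xᵈ⁺¹≡1 = trans (cong (- 1# +_) (trans (cong (x *_) (eval-monomial d x)) xᵈ⁺¹≡1)) (-‿inverseˡ 1#)
    too-many : ¬ (suc d ℕ.< #roots (suc d))
    too-many d+1<#roots = 0≢1 (sym 1≡0)
      where
      enough : List.length P ℕ.≤ List.length roots
      enough = subst₂ ℕ._≤_ (cong suc (sym (length-monomial d))) (sym (length-filter-allFin (λ x → x ^ suc d Fin.≟ 1#))) d+1<#roots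
      P≡0 = few-roots roots (Unique.filter⁺ (λ x → x ^ suc d Fin.≟ 1#) (Unique.allFin⁺ q)) P enough
              (All.map P-root (All.all-filter (λ x → x ^ suc d Fin.≟ 1#) (allFin q)))
      1≡0 : 1# ≡ 0#
      1≡0 = trans (sym (+-identityʳ 1#)) (trans (cong (1# +_) (sym (All.head P≡0))) (-‿inverseʳ 1#))

  -- Each fibre of x ↦ x^d over a nonzero y is empty or a coset of the
  -- d-th roots of unity, so it has at most #roots d elements.
  fibre-bound : ∀ d y → 1 ℕ.≤ d → y ≢ 0# → count (λ x → x ^ d Fin.≟ y) ℕ.≤ #roots d
  fibre-bound d y d≥1 y≢0 with Fin.any? (λ x → x ^ d Fin.≟ y)
  ... | no empty = ℕ.≤-trans (ℕ.≤-reflexive (sum-zero _ (λ x → χ-no (x ^ d Fin.≟ y) (λ xᵈ≡y → empty (x , xᵈ≡y))))) z≤n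
  ... | yes (x₀ , x₀ᵈ≡y) = ℕ.≤-reflexive (begin
    count (λ x → x ^ d Fin.≟ y)              ≡⟨ sum-permute _ (scaling x₀≢0) ⟩
    count (λ x → (x₀ * x) ^ d Fin.≟ y)       ≡⟨ sum-cong-≗ (λ x → χ-⇔ _ _ (to x) (from x)) ⟩
    #roots d                                 ∎)
    where
    open ≡-Reasoning
    x₀≢0 : x₀ ≢ 0#
    x₀≢0 refl = y≢0 (trans (sym x₀ᵈ≡y) (0^ d d≥1))
    to : ∀ x → (x₀ * x) ^ d ≡ y → x ^ d ≡ 1#
    to x e = cancelˡ y≢0 (trans (cong (_* x ^ d) (sym x₀ᵈ≡y)) (trans (sym (*-^ x₀ x d)) (trans e (sym (*-identityʳ y)))))
    from : ∀ x → x ^ d ≡ 1# → (x₀ * x) ^ d ≡ y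
    from x xᵈ≡1 = trans (*-^ x₀ x d) (trans (cong₂ _*_ x₀ᵈ≡y xᵈ≡1) (*-identityʳ y))

  -- If d e = q - 1 then there are at least d d-th roots of unity: x ↦ x^d
  -- maps the q - 1 units into the e-th roots of unity, with fibres of
  -- size at most #roots d, so d e ≤ #roots e · #roots d ≤ e · #roots d.
  roots-lower : ∀ d e → d ℕ.* e ≡ q ∸ 1 → 1 ℕ.≤ d → d ℕ.≤ #roots d
  roots-lower d e de≡q-1 d≥1 = ℕ.*-cancelʳ-≤ d (#roots d) e {{ℕ.>-nonZero e≥1}} (begin
    d ℕ.* e
      ≡⟨ trans de≡q-1 (sym count-nonzero) ⟩
    (∑[ x < q ] χ (nonzero? x))
      ≤⟨ sum-mono {q} unit↦root ⟩
    (∑[ x < q ] ∑[ y < q ] (χ (root y) ℕ.* χ (x ^ d Fin.≟ y)))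
      ≡⟨ ∑-comm {q} {q} (λ x y → χ (root y) ℕ.* χ (x ^ d Fin.≟ y)) ⟩
    (∑[ y < q ] ∑[ x < q ] (χ (root y) ℕ.* χ (x ^ d Fin.≟ y)))
      ≡⟨ sum-cong-≗ (λ y → sym (*-distribˡ-sum (χ (root y)) (λ x → χ (x ^ d Fin.≟ y)))) ⟩
    (∑[ y < q ] (χ (root y) ℕ.* count (λ x → x ^ d Fin.≟ y)))
      ≤⟨ sum-mono {q} fibres ⟩
    (∑[ y < q ] (χ (root y) ℕ.* #roots d))
      ≡⟨ sum-cong-≗ (λ y → ℕ.*-comm (χ (root y)) (#roots d)) ⟩
    (∑[ y < q ] (#roots d ℕ.* χ (root y)))
      ≡⟨ sym (*-distribˡ-sum (#roots d) (λ y → χ (root y))) ⟩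
    #roots d ℕ.* #roots e
      ≤⟨ ℕ.*-monoʳ-≤ (#roots d) (roots-upper′ e e≥1) ⟩
    #roots d ℕ.* e                                                    ∎)
    where
    open ℕ.≤-Reasoning
    root = λ y → y ^ e Fin.≟ 1#
    e≥1 : 1 ℕ.≤ e
    e≥1 = ℕ.n≢0⇒n>0 λ { refl → ℕ.<⇒≢ (ℕ.∸-monoˡ-≤ 1 q≥2) (trans (sym (ℕ.*-zeroʳ d)) de≡q-1) }
    roots-upper′ : ∀ m → 1 ℕ.≤ m → #roots m ℕ.≤ m
    roots-upper′ (suc m) _ = roots-upper m
    unit↦root : ∀ x → χ (nonzero? x) ℕ.≤ ∑[ y < q ] (χ (root y) ℕ.* χ (x ^ d Fin.≟ y))
    unit↦root x with nonzero? x
    ... | no _    = z≤n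
    ... | yes x≢0 = ℕ.≤-reflexive (sym (trans (sum-select (λ y → χ (root y)) (x ^ d))
                      (χ-yes (root (x ^ d)) (trans (sym (^-* x d e)) (trans (cong (x ^_) de≡q-1) (fermat x x≢0))))))
    fibres : ∀ y → χ (root y) ℕ.* count (λ x → x ^ d Fin.≟ y) ℕ.≤ χ (root y) ℕ.* #roots d
    fibres y with root y
    ... | no _      = z≤n
    ... | yes yᵉ≡1 = ℕ.+-monoˡ-≤ 0 (fibre-bound d y d≥1 (root-of-unity≢0 e e≥1 yᵉ≡1))

  -- For m ≥ 1, x^m = 1 iff x^g = 1 with g = gcd(m, q - 1): one direction
  -- because g ∣ m, the other by Bézout and Fermat.
  root-of-unity-gcd : ∀ m x → 1 ℕ.≤ m → x ^ m ≡ 1# → x ^ gcd m (q ∸ 1) ≡ 1#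
  root-of-unity-gcd m x m≥1 xᵐ≡1 = from-Bézout (Bézout.identity (gcd-GCD m (q ∸ 1)))
    where
    g = gcd m (q ∸ 1)
    xᴺ≡1 : x ^ (q ∸ 1) ≡ 1#
    xᴺ≡1 = fermat x (root-of-unity≢0 m m≥1 xᵐ≡1)
    shift : ∀ s t → g ℕ.+ s ≡ t → x ^ s ≡ 1# → x ^ t ≡ 1# → x ^ g ≡ 1#
    shift s t g+s≡t xˢ≡1 xᵗ≡1 = begin
      x ^ g              ≡⟨ sym (*-identityʳ _) ⟩
      x ^ g * 1#         ≡⟨ cong (x ^ g *_) (sym xˢ≡1) ⟩
      x ^ g * x ^ s      ≡⟨ sym (^-+ x g s) ⟩
      x ^ (g ℕ.+ s)      ≡⟨ cong (x ^_) g+s≡t ⟩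
      x ^ t              ≡⟨ xᵗ≡1 ⟩
      1#                 ∎
      where open ≡-Reasoning
    from-Bézout : Bézout.Identity g m (q ∸ 1) → x ^ g ≡ 1#
    from-Bézout (Bézout.+- a b eq) = shift _ _ eq (^-one x (q ∸ 1) b xᴺ≡1) (^-one x m a xᵐ≡1)
    from-Bézout (Bézout.-+ a b eq) = shift _ _ eq (^-one x m a xᵐ≡1) (^-one x (q ∸ 1) b xᴺ≡1)

  roots-of-unity-count : ∀ m → 1 ℕ.≤ m → #roots m ≡ gcd m (q ∸ 1)
  roots-of-unity-count m m≥1 = trans same-roots (ℕ.≤-antisym (upper g g≥1) (roots-lower g e ge≡q-1 g≥1))
    where
    g = gcd m (q ∸ 1)
    g∣m = gcd[m,n]∣m m (q ∸ 1)
    e = _∣_.quotient (gcd[m,n]∣n m (q ∸ 1))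
    ge≡q-1 : g ℕ.* e ≡ q ∸ 1
    ge≡q-1 = trans (ℕ.*-comm g e) (sym (_∣_.equality (gcd[m,n]∣n m (q ∸ 1))))
    g≥1 : 1 ℕ.≤ g
    g≥1 = ℕ.n≢0⇒n>0 (λ g≡0 → ℕ.<⇒≢ m≥1 (sym (gcd[m,n]≡0⇒m≡0 g≡0)))
    upper : ∀ k → 1 ℕ.≤ k → #roots k ℕ.≤ k
    upper (suc k) _ = roots-upper k
    same-roots : #roots m ≡ #roots g
    same-roots = sum-cong-≗ λ x → χ-⇔ (x ^ m Fin.≟ 1#) (x ^ g Fin.≟ 1#) (root-of-unity-gcd m x m≥1)
      (λ xᵍ≡1 → trans (cong (x ^_) (_∣_.equality g∣m)) (^-one x g (_∣_.quotient g∣m) xᵍ≡1))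

module PowerMap {q : ℕ} (F : FiniteField q) (n : ℕ) where
  open import Data.Nat as ℕ using (ℕ; zero; suc; _∸_; z≤n; s≤s)
  import Data.Nat.Properties as ℕ
  open import Data.Nat.GCD using (gcd)
  import Data.Fin.Properties as Fin
  open import Relation.Nullary using (yes; no)
  open import Relation.Binary.PropositionalEquality
  open Counting
  open FieldArithmetic F
  open RootsOfUnity F using (#roots; count-zero; roots-of-unity-count)

  power : Carrier → Carrier
  power x = x ^ n

  iterate-power : ∀ r x → iter power r x ≡ x ^ (n ℕ.^ r)
  iterate-power zero    x = sym (*-identityʳ x)
  iterate-power (suc r) x = begin
    (iter power r x) ^ n       ≡⟨ cong (_^ n) (iterate-power r x) ⟩
    (x ^ (n ℕ.^ r)) ^ n        ≡⟨ sym (^-* x (n ℕ.^ r) n) ⟩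
    x ^ (n ℕ.^ r ℕ.* n)        ≡⟨ cong (x ^_) (ℕ.*-comm (n ℕ.^ r) n) ⟩
    x ^ (n ℕ.^ suc r)          ∎
    where open ≡-Reasoning

  fixed-indicator : ∀ k x → 1 ℕ.≤ k → χ (x ^ suc k Fin.≟ x) ≡ χ (x Fin.≟ 0#) ℕ.+ χ (x ^ k Fin.≟ 1#)
  fixed-indicator k x k≥1 with x Fin.≟ 0#
  ... | yes refl = trans (χ-yes (0# ^ suc k Fin.≟ 0#) (0^ (suc k) (s≤s z≤n)))
                         (cong suc (sym (χ-no (0# ^ k Fin.≟ 1#) (λ 0ᵏ≡1 → root-of-unity≢0 k k≥1 0ᵏ≡1 refl))))
  ... | no x≢0   = χ-⇔ (x ^ suc k Fin.≟ x) (x ^ k Fin.≟ 1#)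
    (λ xᵏ⁺¹≡x → cancelˡ x≢0 (trans xᵏ⁺¹≡x (sym (*-identityʳ x))))
    (λ xᵏ≡1 → trans (cong (x *_) xᵏ≡1) (*-identityʳ x))

  fixed-points-count : 2 ℕ.≤ n → ∀ r → 1 ℕ.≤ r →
    count (λ x → iter power r x Fin.≟ x) ≡ suc (gcd (n ℕ.^ r ∸ 1) (q ∸ 1))
  fixed-points-count n≥2 r@(suc r′) _ = begin
    count (λ x → iter power r x Fin.≟ x)                            ≡⟨ sum-cong-≗ as-power ⟩
    ∑[ x < q ] χ (x ^ suc k Fin.≟ x)                                 ≡⟨ sum-cong-≗ (λ x → fixed-indicator k x k≥1) ⟩
    ∑[ x < q ] (χ (x Fin.≟ 0#) ℕ.+ χ (x ^ k Fin.≟ 1#))               ≡⟨ ∑-distrib-+ (λ x → χ (x Fin.≟ 0#)) (λ x → χ (x ^ k Fin.≟ 1#)) ⟩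
    count (Fin._≟ 0#) ℕ.+ #roots k                                  ≡⟨ cong₂ ℕ._+_ count-zero (roots-of-unity-count k k≥1) ⟩
    suc (gcd k (q ∸ 1))                                              ∎
    where
    open ≡-Reasoning
    k = n ℕ.^ r ∸ 1
    nʳ≥2 : 2 ℕ.≤ n ℕ.^ r
    nʳ≥2 = ℕ.≤-trans n≥2 (ℕ.m≤m*n n (n ℕ.^ r′) {{ℕ.m^n≢0 n r′ {{ℕ.>-nonZero (ℕ.≤-trans (s≤s z≤n) n≥2)}}}})
    k≥1 : 1 ℕ.≤ k
    k≥1 = ℕ.∸-monoˡ-≤ 1 nʳ≥2
    nʳ≡1+k : n ℕ.^ r ≡ suc k
    nʳ≡1+k = sym (ℕ.m+[n∸m]≡n (ℕ.≤-trans (s≤s z≤n) nʳ≥2))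
    as-power : ∀ x → χ (iter power r x Fin.≟ x) ≡ χ (x ^ suc k Fin.≟ x)
    as-power x = cong (λ y → χ (y Fin.≟ x)) (trans (iterate-power r x) (cong (x ^_) nʳ≡1+k))

module Periods {q : ℕ} (f : Fin q → Fin q) where
  open import Data.Nat as ℕ using (ℕ; zero; suc; _+_; _*_; _≤_; _<_; z≤n; s≤s)
  import Data.Nat.Properties as ℕ
  open import Data.Nat.DivMod using (_%_; _/_; m≡m%n+[m/n]*n; m%n<n)
  open import Data.Nat.Divisibility using (_∣_; _∣?_; divides; m%n≡0⇒n∣m)
  open import Data.Nat.Induction using (<-rec)
  open import Data.Fin using (Fin; toℕ; fromℕ<)
  import Data.Fin.Properties as Fin
  open import Data.Product using (_,_; ∃; proj₁; proj₂; _×_)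
  open import Data.Empty using (⊥-elim)
  open import Relation.Nullary using (yes; no)
  open import Relation.Nullary.Decidable using (_×-dec_)
  open import Relation.Binary using (tri<; tri≈; tri>)
  open import Relation.Binary.PropositionalEquality
  open Counting

  iter-+ : ∀ a b x → iter f (a + b) x ≡ iter f a (iter f b x)
  iter-+ zero    b x = refl
  iter-+ (suc a) b x = cong f (iter-+ a b x)

  iter-comm : ∀ a b x → iter f a (iter f b x) ≡ iter f b (iter f a x)
  iter-comm a b x = trans (sym (iter-+ a b x)) (trans (cong (λ t → iter f t x) (ℕ.+-comm a b)) (iter-+ b a x))

  iter-* : ∀ m d x → iter f d x ≡ x → iter f (m * d) x ≡ x
  iter-* zero    d x _      = refl
  iter-* (suc m) d x fixed = trans (iter-+ d (m * d) x) (trans (cong (iter f d) (iter-* m d x fixed)) fixed)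

  iter-mod : ∀ r x .{{_ : ℕ.NonZero r}} → iter f r x ≡ x → ∀ t → iter f t x ≡ iter f (t % r) x
  iter-mod r x fixed t = begin
    iter f t x                          ≡⟨ cong (λ u → iter f u x) (m≡m%n+[m/n]*n t r) ⟩
    iter f (t % r + t / r * r) x        ≡⟨ iter-+ (t % r) (t / r * r) x ⟩
    iter f (t % r) (iter f (t / r * r) x) ≡⟨ cong (iter f (t % r)) (iter-* (t / r) r x fixed) ⟩
    iter f (t % r) x                    ∎
    where open ≡-Reasoning

  periodic-minimal : ∀ {d x} → IsPeriodicPoint f d x → ∀ k → 1 ≤ k → k < d → iter f k x ≢ x
  periodic-minimal (_ , _ , minimal) k k≥1 k<d fixed = minimal (fromℕ< k<d)
    (subst (1 ≤_) (sym (Fin.toℕ-fromℕ< k<d)) k≥1) (subst (λ t → iter f t _ ≡ _) (sym (Fin.toℕ-fromℕ< k<d)) fixed)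

  mkPeriodic : ∀ {d x} → 1 ≤ d → iter f d x ≡ x → (∀ k → 1 ≤ k → k < d → iter f k x ≢ x) → IsPeriodicPoint f d x
  mkPeriodic d≥1 fixed minimal = d≥1 , fixed , λ k k≥1 → minimal (toℕ k) k≥1 (Fin.toℕ<n k)

  period-exists : ∀ r x → 1 ≤ r → iter f r x ≡ x → ∃ λ d → d ≤ r × IsPeriodicPoint f d x
  period-exists = <-rec _ search
    where
    search : ∀ r → (∀ {k} → k < r → ∀ x → 1 ≤ k → iter f k x ≡ x → ∃ λ d → d ≤ k × IsPeriodicPoint f d x) →
             ∀ x → 1 ≤ r → iter f r x ≡ x → ∃ λ d → d ≤ r × IsPeriodicPoint f d x
    search r smaller x r≥1 fixed with Fin.any? {n = r} (λ k → (1 ℕ.≤? toℕ k) ×-dec (iter f (toℕ k) x Fin.≟ x))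
    ... | yes (k , k≥1 , fixedₖ) with smaller (Fin.toℕ<n k) x k≥1 fixedₖ
    ...   | d , d≤k , periodic = d , ℕ.≤-trans d≤k (ℕ.<⇒≤ (Fin.toℕ<n k)) , periodic
    search r smaller x r≥1 fixed | no none = r , ℕ.≤-refl , mkPeriodic r≥1 fixed (λ k k≥1 k<r fixedₖ →
      none (fromℕ< k<r , subst (1 ≤_) (sym (Fin.toℕ-fromℕ< k<r)) k≥1 ,
            subst (λ t → iter f t x ≡ x) (sym (Fin.toℕ-fromℕ< k<r)) fixedₖ))

  period-unique : ∀ {d d′ x} → IsPeriodicPoint f d x → IsPeriodicPoint f d′ x → d ≡ d′
  period-unique {d} {d′} p p′ with ℕ.<-cmp d d′
  ... | tri≈ _ d≡d′ _ = d≡d′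
  ... | tri< d<d′ _ _ = ⊥-elim (periodic-minimal p′ d (proj₁ p) d<d′ (proj₁ (proj₂ p)))
  ... | tri> _ _ d′<d = ⊥-elim (periodic-minimal p d′ (proj₁ p′) d′<d (proj₁ (proj₂ p′)))

  period-divides : ∀ {d x} r → IsPeriodicPoint f d x → iter f r x ≡ x → d ∣ r
  period-divides {d} {x} r p fixed = m%n≡0⇒n∣m r d r%d≡0
    where
    instance
      d≢0 : ℕ.NonZero d
      d≢0 = ℕ.>-nonZero (proj₁ p)
    r%d≡0 : r % d ≡ 0
    r%d≡0 with r % d in eq
    ... | zero  = refl
    ... | suc t = ⊥-elim (periodic-minimal p (suc t) (s≤s z≤n) (subst (_< d) eq (m%n<n r d))
                   (subst (λ u → iter f u x ≡ x) eq (trans (sym (iter-mod d x (proj₁ (proj₂ p)) r)) fixed)))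

  #periodic : ℕ → ℕ
  #periodic d = count (periodic? f d)

  -- For a point x and r ≥ 1, the d ∣ r with x d-periodic are: its period if
  -- f^r x = x, and none otherwise.
  fixed-indicator : ∀ r x → 1 ≤ r →
    χ (iter f r x Fin.≟ x) ≡ ∑[ k < r ] (χ (suc (toℕ k) ∣? r) * χ (periodic? f (suc (toℕ k)) x))
  fixed-indicator r x r≥1 with iter f r x Fin.≟ x
  ... | no not-fixed = sym (sum-zero {r} _ λ k → trans (χ-× (suc (toℕ k) ∣? r) (periodic? f (suc (toℕ k)) x))
          (χ-no ((suc (toℕ k) ∣? r) ×-dec (periodic? f (suc (toℕ k)) x)) λ { (divides m r≡md , p) →
            not-fixed (subst (λ t → iter f t x ≡ x) (sym r≡md) (iter-* m _ x (proj₁ (proj₂ p)))) }))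
  ... | yes fixed with period-exists r x r≥1 fixed
  ...   | zero , _ , p = ⊥-elim (ℕ.<⇒≱ (proj₁ p) z≤n)
  ...   | suc d′ , d≤r , p = sym (trans (sum-cong-≗ only-period) (count-singleton j))
    where
    j : Fin r
    j = fromℕ< d≤r
    only-period : ∀ k → χ (suc (toℕ k) ∣? r) * χ (periodic? f (suc (toℕ k)) x) ≡ χ (j Fin.≟ k)
    only-period k = trans (χ-× (suc (toℕ k) ∣? r) (periodic? f (suc (toℕ k)) x)) (χ-⇔ _ (j Fin.≟ k)
      (λ (_ , pₖ) → Fin.toℕ-injective (trans (Fin.toℕ-fromℕ< d≤r) (ℕ.suc-injective (period-unique p pₖ))))
      (λ { refl → subst (λ t → suc t ∣ r × IsPeriodicPoint f (suc t) x) (sym (Fin.toℕ-fromℕ< d≤r))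
                    (period-divides r p fixed , p) }))

  -- #Fix(f^r) = Σ_{d ∣ r} #periodic d, summing over d = k + 1 with k < r.
  fixed-points-decomposition : ∀ r → 1 ≤ r →
    count (λ x → iter f r x Fin.≟ x) ≡ ∑[ k < r ] (χ (suc (toℕ k) ∣? r) * #periodic (suc (toℕ k)))
  fixed-points-decomposition r r≥1 = begin
    count (λ x → iter f r x Fin.≟ x)
      ≡⟨ sum-cong-≗ (λ x → fixed-indicator r x r≥1) ⟩
    ∑[ x < q ] ∑[ k < r ] (χ (divides? k) * χ (periodic? f (suc (toℕ k)) x))
      ≡⟨ ∑-comm {q} {r} (λ x k → χ (divides? k) * χ (periodic? f (suc (toℕ k)) x)) ⟩
    ∑[ k < r ] ∑[ x < q ] (χ (divides? k) * χ (periodic? f (suc (toℕ k)) x))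
      ≡⟨ sum-cong-≗ (λ k → sym (*-distribˡ-sum (χ (divides? k)) (λ x → χ (periodic? f (suc (toℕ k)) x)))) ⟩
    ∑[ k < r ] (χ (divides? k) * #periodic (suc (toℕ k)))                  ∎
    where
    open ≡-Reasoning
    divides? = λ (k : Fin r) → suc (toℕ k) ∣? r

module Cycles {q : ℕ} (f : Fin q → Fin q) where
  open import Data.Nat as ℕ using (ℕ; _+_; _*_; _∸_; _≤_; _<_)
  import Data.Nat.Properties as ℕ
  open import Data.Nat.DivMod using (m%n<n)
  open import Data.Fin using (Fin; toℕ; fromℕ<)
  import Data.Fin.Properties as Fin
  open import Data.Fin.Subset using (Subset; _∈_)
  open import Data.Fin.Subset.Properties using (_∈?_; ⊆-antisym)
  open import Data.Vec using (tabulate)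
  import Data.Vec.Properties as Vec
  open import Data.Bool using (true)
  open import Data.Product using (_,_; ∃; proj₁; proj₂; _×_)
  open import Data.Empty using (⊥-elim)
  open import Relation.Nullary using (Dec; does; yes; no)
  open import Relation.Nullary.Decidable using (dec-true)
  open import Relation.Binary using (tri<; tri≈; tri>)
  open import Relation.Binary.PropositionalEquality
  open Counting
  open Periods f

  true⇒witness : ∀ {p} {P : Set p} (d : Dec P) → does d ≡ true → P
  true⇒witness (yes p) _ = p

  orbit : ℕ → Fin q → Subset q
  orbit r x = tabulate (λ y → does (Fin.any? (λ (j : Fin r) → iter f (toℕ j) x Fin.≟ y)))

  ∈-orbit⁻ : ∀ {r x y} → y ∈ orbit r x → ∃ λ (j : Fin r) → iter f (toℕ j) x ≡ y
  ∈-orbit⁻ {r} {x} {y} y∈orbit = true⇒witness (Fin.any? (λ (j : Fin r) → iter f (toℕ j) x Fin.≟ y))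
    (trans (sym (Vec.lookup∘tabulate _ y)) (Vec.[]=⇒lookup y∈orbit))

  ∈-orbit⁺ : ∀ {r x y} → (∃ λ (j : Fin r) → iter f (toℕ j) x ≡ y) → y ∈ orbit r x
  ∈-orbit⁺ {r} {x} {y} reached = Vec.lookup⇒[]= y _
    (trans (Vec.lookup∘tabulate _ y) (dec-true (Fin.any? (λ (j : Fin r) → iter f (toℕ j) x Fin.≟ y)) reached))

  reduce : ∀ r z → 1 ≤ r → iter f r z ≡ z → ∀ t → ∃ λ (k : Fin r) → iter f (toℕ k) z ≡ iter f t z
  reduce r z r≥1 fixed t = fromℕ< (m%n<n t r) ,
    trans (cong (λ u → iter f u z) (Fin.toℕ-fromℕ< (m%n<n t r))) (sym (iter-mod r z fixed t))
    where instance r≢0 = ℕ.>-nonZero r≥1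

  undo : ∀ r j z → j ≤ r → iter f r z ≡ z → iter f (r ∸ j) (iter f j z) ≡ z
  undo r j z j≤r fixed = trans (sym (iter-+ (r ∸ j) j z)) (trans (cong (λ t → iter f t z) (ℕ.m∸n+n≡m j≤r)) fixed)

  periodic-iterate : ∀ {r x} j → j ≤ r → IsPeriodicPoint f r x → IsPeriodicPoint f r (iter f j x)
  periodic-iterate {r} {x} j j≤r p@(r≥1 , fixed , _) = mkPeriodic r≥1
    (trans (iter-comm r j x) (cong (iter f j) fixed))
    (λ k k≥1 k<r fixedₖ → periodic-minimal p k k≥1 k<r (begin
      iter f k x                              ≡⟨ cong (iter f k) (sym (undo r j x j≤r fixed)) ⟩
      iter f k (iter f (r ∸ j) (iter f j x))  ≡⟨ iter-comm k (r ∸ j) _ ⟩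
      iter f (r ∸ j) (iter f k (iter f j x))  ≡⟨ cong (iter f (r ∸ j)) fixedₖ ⟩
      iter f (r ∸ j) (iter f j x)             ≡⟨ undo r j x j≤r fixed ⟩
      x                                       ∎))
    where open ≡-Reasoning

  iterates-distinct : ∀ {r x} → IsPeriodicPoint f r x → ∀ (i j : Fin r) → toℕ i < toℕ j →
    iter f (toℕ i) x ≢ iter f (toℕ j) x
  iterates-distinct {r} {x} p i j i<j fᶦx≡fʲx = periodic-minimal p (r ∸ toℕ j + toℕ i) k≥1 k<r (begin
    iter f (r ∸ toℕ j + toℕ i) x         ≡⟨ iter-+ (r ∸ toℕ j) (toℕ i) x ⟩
    iter f (r ∸ toℕ j) (iter f (toℕ i) x) ≡⟨ cong (iter f (r ∸ toℕ j)) fᶦx≡fʲx ⟩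
    iter f (r ∸ toℕ j) (iter f (toℕ j) x) ≡⟨ undo r (toℕ j) x j≤r (proj₁ (proj₂ p)) ⟩
    x                                     ∎)
    where
    open ≡-Reasoning
    j≤r = ℕ.<⇒≤ (Fin.toℕ<n j)
    k≥1 : 1 ≤ r ∸ toℕ j + toℕ i
    k≥1 = ℕ.≤-trans (ℕ.m<n⇒0<n∸m (Fin.toℕ<n j)) (ℕ.m≤m+n _ _)
    k<r : r ∸ toℕ j + toℕ i < r
    k<r = ℕ.≤-trans (ℕ.+-monoʳ-< (r ∸ toℕ j) i<j) (ℕ.≤-reflexive (ℕ.m∸n+n≡m j≤r))

  iterates-injective : ∀ {r x} → IsPeriodicPoint f r x → ∀ (i j : Fin r) → iter f (toℕ i) x ≡ iter f (toℕ j) x → i ≡ j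
  iterates-injective p i j fᶦx≡fʲx with ℕ.<-cmp (toℕ i) (toℕ j)
  ... | tri≈ _ i≡j _ = Fin.toℕ-injective i≡j
  ... | tri< i<j _ _ = ⊥-elim (iterates-distinct p i j i<j fᶦx≡fʲx)
  ... | tri> _ _ j<i = ⊥-elim (iterates-distinct p j i j<i (sym fᶦx≡fʲx))

  orbit-cycle : ∀ {r x} → IsPeriodicPoint f r x → IsCycle f r (orbit r x)
  orbit-cycle {r} {x} p = x , ∈-orbit⁺ (fromℕ< r≥1 , cong (λ t → iter f t x) (Fin.toℕ-fromℕ< r≥1)) , p ,
    λ y → ∈-orbit⁻ , ∈-orbit⁺
    where r≥1 = proj₁ p

  cycle-orbit : ∀ {r S} (c : IsCycle f r S) → S ≡ orbit r (proj₁ c)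
  cycle-orbit (x₀ , _ , _ , members) =
    ⊆-antisym (λ y∈S → ∈-orbit⁺ (proj₁ (members _) y∈S)) (λ y∈orbit → proj₂ (members _) (∈-orbit⁻ y∈orbit))

  orbit-iterate : ∀ {r x} j → j ≤ r → IsPeriodicPoint f r x → orbit r (iter f j x) ≡ orbit r x
  orbit-iterate {r} {x} j j≤r p@(r≥1 , fixed , _) = ⊆-antisym forward backward
    where
    fixedⱼ = proj₁ (proj₂ (periodic-iterate j j≤r p))
    forward : ∀ {y} → y ∈ orbit r (iter f j x) → y ∈ orbit r x
    forward y∈orbit with ∈-orbit⁻ {r} y∈orbit
    ... | k , fᵏfʲx≡y with reduce r x r≥1 fixed (toℕ k + j)
    ...   | k′ , e = ∈-orbit⁺ (k′ , trans e (trans (iter-+ (toℕ k) j x) fᵏfʲx≡y))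
    backward : ∀ {y} → y ∈ orbit r x → y ∈ orbit r (iter f j x)
    backward y∈orbit with ∈-orbit⁻ {r} y∈orbit
    ... | k , fᵏx≡y with reduce r (iter f j x) r≥1 fixedⱼ (toℕ k + (r ∸ j))
    ...   | k′ , e = ∈-orbit⁺ (k′ , trans e (trans (iter-+ (toℕ k) (r ∸ j) _)
                        (trans (cong (iter f (toℕ k)) (undo r j x j≤r fixed)) fᵏx≡y)))

  in-cycle : ∀ {r S x} → IsCycle f r S → x ∈ S → IsPeriodicPoint f r x × S ≡ orbit r x
  in-cycle {r} {S} {x} c@(x₀ , _ , p₀ , members) x∈S with proj₁ (members x) x∈S
  ... | j , refl = periodic-iterate (toℕ j) j≤r p₀ , trans (cycle-orbit c) (sym (orbit-iterate (toℕ j) j≤r p₀))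
    where j≤r = ℕ.<⇒≤ (Fin.toℕ<n j)

  cycle-size : ∀ {r S} → IsCycle f r S → count (_∈? S) ≡ r
  cycle-size {r} {S} (x₀ , _ , p₀ , members) = trans
    (sum-cong-≗ (λ y → χ-⇔ (y ∈? S) (Fin.any? (λ j → iter f (toℕ j) x₀ Fin.≟ y)) (proj₁ (members y)) (proj₂ (members y))))
    (count-image (λ j → iter f (toℕ j) x₀) (iterates-injective p₀))

  -- Double counting the pairs (x, S) with S an r-cycle containing x:
  -- each r-periodic x lies in exactly one r-cycle (its orbit), and each
  -- r-cycle contains exactly r points.
  cycles-count : ∀ r → r * numCycles f r ≡ numPeriodicPoints f r
  cycles-count r = sym (begin
    numPeriodicPoints f r                                                   ≡⟨ length-filter-allFin (periodic? f r) ⟩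
    ∑[ x < q ] χ (periodic? f r x)                                         ≡⟨ sum-cong-≗ in-its-orbit ⟩
    ∑[ x < q ] listSum Ss (λ S → χ (periodic? f r x) * χ (S ≟ₛ orbit r x)) ≡⟨ sum-cong-≗ (λ x → listSum-cong Ss (pair x)) ⟩
    ∑[ x < q ] listSum Ss (λ S → χ (cycle? f r S) * χ (x ∈? S))            ≡⟨ sym (listSum-∑ Ss (λ S x → χ (cycle? f r S) * χ (x ∈? S))) ⟩
    listSum Ss (λ S → ∑[ x < q ] (χ (cycle? f r S) * χ (x ∈? S)))          ≡⟨ listSum-cong Ss size ⟩
    listSum Ss (λ S → r * χ (cycle? f r S))                                ≡⟨ listSum-*ˡ Ss r (λ S → χ (cycle? f r S)) ⟩
    r * listSum Ss (λ S → χ (cycle? f r S))                                ≡⟨ cong (r *_) (sym (length-filter (cycle? f r) Ss)) ⟩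
    r * numCycles f r                                                       ∎)
    where
    open ≡-Reasoning
    Ss = allSubsets q
    in-its-orbit : ∀ x → χ (periodic? f r x) ≡ listSum Ss (λ S → χ (periodic? f r x) * χ (S ≟ₛ orbit r x))
    in-its-orbit x = begin
      χ (periodic? f r x)
        ≡⟨ sym (ℕ.*-identityʳ _) ⟩
      χ (periodic? f r x) * 1
        ≡⟨ cong (χ (periodic? f r x) *_) (sym (allSubsets-once q (orbit r x))) ⟩
      χ (periodic? f r x) * listSum Ss (λ S → χ (S ≟ₛ orbit r x))
        ≡⟨ sym (listSum-*ˡ Ss (χ (periodic? f r x)) (λ S → χ (S ≟ₛ orbit r x))) ⟩
      listSum Ss (λ S → χ (periodic? f r x) * χ (S ≟ₛ orbit r x))   ∎
    pair : ∀ x S → χ (periodic? f r x) * χ (S ≟ₛ orbit r x) ≡ χ (cycle? f r S) * χ (x ∈? S)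
    pair x S = trans (χ-× (periodic? f r x) (S ≟ₛ orbit r x)) (trans (χ-⇔ _ _
      (λ { (p , refl) → orbit-cycle p , proj₁ (proj₂ (orbit-cycle p)) })
      (λ (c , x∈S) → in-cycle c x∈S))
      (sym (χ-× (cycle? f r S) (x ∈? S))))
    size : ∀ S → ∑[ x < q ] (χ (cycle? f r S) * χ (x ∈? S)) ≡ r * χ (cycle? f r S)
    size S with cycle? f r S
    ... | yes c = trans (sum-cong-≗ (λ x → ℕ.+-identityʳ (χ (x ∈? S)))) (trans (cycle-size c) (sym (ℕ.*-identityʳ r)))
    ... | no _  = trans (sum-zero {q} _ (λ _ → refl)) (sym (ℕ.*-zeroʳ r))

module DivisorSums where
  open import Data.Nat as ℕ using (ℕ; zero; suc; z≤n; s≤s; _≤_; _<_)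
  import Data.Nat.Properties as ℕ
  open import Data.Nat.Divisibility using (_∣_; _∣?_; ∣⇒≤)
  open import Data.Integer as ℤ using (ℤ; +_; 0ℤ; 1ℤ; -_; _+_; _*_)
  import Data.Integer.Properties as ℤ
  open import Data.Fin as Fin using (Fin; toℕ)
  import Data.Fin.Properties as Fin
  open import Data.List using (length; filter; applyUpTo; map; foldr)
  open import Relation.Nullary using (Dec; yes; no; ¬_)
  open import Relation.Unary using (Pred; Decidable)
  open import Relation.Binary.PropositionalEquality
  open import Function using (_∘_)
  open Counting using (χ; χ-yes; χ-no)
  module ℕΣ = Counting
  open import Algebra.Properties.CommutativeMonoid.Sum ℤ.+-0-commutativeMonoid
    using (sum-cong-≗; ∑-distrib-+; ∑-comm) renaming (sum to ∑)
  open import Algebra.Properties.Semiring.Sum ℤ.+-*-semiring using (*-distribˡ-sum)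
  open ≡-Reasoning

  ι : ∀ {p} {P : Set p} → Dec P → ℤ
  ι d = + χ d

  ι-yes : ∀ {p} {P : Set p} (d : Dec P) → P → ι d ≡ 1ℤ
  ι-yes d p = cong +_ (χ-yes d p)

  ι-no : ∀ {p} {P : Set p} (d : Dec P) → ¬ P → ι d ≡ 0ℤ
  ι-no d ¬p = cong +_ (χ-no d ¬p)

  Σ< : ℕ → (ℕ → ℤ) → ℤ
  Σ< n g = ∑ {n} (g ∘ toℕ)

  +-∑ : ∀ n (h : Fin n → ℕ) → + ℕΣ.sum h ≡ ∑ (λ i → + h i)
  +-∑ zero    h = refl
  +-∑ (suc n) h = trans (ℤ.pos-+ (h Fin.zero) _) (cong (_+_ (+ h Fin.zero)) (+-∑ n (h ∘ Fin.suc)))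

  length-filter-upTo : ∀ {p} {P : Pred ℕ p} (P? : Decidable P) n (h : ℕ → ℕ) →
    + length (filter P? (applyUpTo h n)) ≡ Σ< n (λ k → ι (P? (h k)))
  length-filter-upTo P? zero    h = refl
  length-filter-upTo P? (suc n) h with P? (h 0)
  ... | yes _ = trans (ℤ.pos-+ 1 _) (cong (_+_ 1ℤ) (length-filter-upTo P? n (h ∘ suc)))
  ... | no _  = trans (length-filter-upTo P? n (h ∘ suc)) (sym (ℤ.+-identityˡ _))

  foldr-filter-upTo : ∀ {p} {P : Pred ℕ p} (P? : Decidable P) (g : ℕ → ℤ) n (h : ℕ → ℕ) →
    foldr _+_ 0ℤ (map g (filter P? (applyUpTo h n))) ≡ Σ< n (λ k → ι (P? (h k)) * g (h k))
  foldr-filter-upTo P? g zero    h = refl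
  foldr-filter-upTo P? g (suc n) h with P? (h 0)
  ... | yes _ = cong₂ _+_ (sym (ℤ.*-identityˡ (g (h 0)))) (foldr-filter-upTo P? g n (h ∘ suc))
  ... | no _  = trans (foldr-filter-upTo P? g n (h ∘ suc)) (sym (ℤ.+-identityˡ _))

  Σ<-cong : ∀ n {g h : ℕ → ℤ} → (∀ k → k < n → g k ≡ h k) → Σ< n g ≡ Σ< n h
  Σ<-cong n g≗h = sum-cong-≗ (λ k → g≗h (toℕ k) (Fin.toℕ<n k))

  Σ<-zero : ∀ n (g : ℕ → ℤ) → (∀ k → k < n → g k ≡ 0ℤ) → Σ< n g ≡ 0ℤ
  Σ<-zero zero    g _   = refl
  Σ<-zero (suc n) g g≡0 = cong₂ _+_ (g≡0 0 (s≤s z≤n)) (Σ<-zero n (g ∘ suc) (λ k k<n → g≡0 (suc k) (s≤s k<n)))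

  Σ<-+ : ∀ n (g h : ℕ → ℤ) → Σ< n (λ k → g k + h k) ≡ Σ< n g + Σ< n h
  Σ<-+ n g h = ∑-distrib-+ {n} (g ∘ toℕ) (h ∘ toℕ)

  Σ<-*ˡ : ∀ n c (g : ℕ → ℤ) → Σ< n (λ k → c * g k) ≡ c * Σ< n g
  Σ<-*ˡ n c g = sym (*-distribˡ-sum {n} c (g ∘ toℕ))

  Σ<-neg : ∀ n (g : ℕ → ℤ) → Σ< n (λ k → - g k) ≡ - Σ< n g
  Σ<-neg n g = begin
    Σ< n (λ k → - g k)        ≡⟨ Σ<-cong n (λ k _ → sym (ℤ.-1*i≡-i (g k))) ⟩
    Σ< n (λ k → - 1ℤ * g k)   ≡⟨ Σ<-*ˡ n (- 1ℤ) g ⟩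
    - 1ℤ * Σ< n g             ≡⟨ ℤ.-1*i≡-i _ ⟩
    - Σ< n g                  ∎

  Σ<-comm : ∀ m n (g : ℕ → ℕ → ℤ) → Σ< m (λ i → Σ< n (g i)) ≡ Σ< n (λ j → Σ< m (λ i → g i j))
  Σ<-comm m n g = ∑-comm {m} {n} (λ i j → g (toℕ i) (toℕ j))

  Σ<-split : ∀ a b (g : ℕ → ℤ) → Σ< (a ℕ.+ b) g ≡ Σ< a g + Σ< b (λ k → g (a ℕ.+ k))
  Σ<-split zero    b g = sym (ℤ.+-identityˡ _)
  Σ<-split (suc a) b g = trans (cong (_+_ (g 0)) (Σ<-split a b (g ∘ suc))) (sym (ℤ.+-assoc (g 0) _ _))

  Σ<-extend : ∀ m n (g : ℕ → ℤ) → m ≤ n → (∀ k → m ≤ k → g k ≡ 0ℤ) → Σ< n g ≡ Σ< m g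
  Σ<-extend m n g m≤n vanish = begin
    Σ< n g
      ≡⟨ cong (λ t → Σ< t g) (sym (ℕ.m+[n∸m]≡n m≤n)) ⟩
    Σ< (m ℕ.+ (n ℕ.∸ m)) g
      ≡⟨ Σ<-split m (n ℕ.∸ m) g ⟩
    Σ< m g + Σ< (n ℕ.∸ m) (λ k → g (m ℕ.+ k))
      ≡⟨ cong (_+_ (Σ< m g)) (Σ<-zero (n ℕ.∸ m) (λ k → g (m ℕ.+ k)) (λ k _ → vanish (m ℕ.+ k) (ℕ.m≤m+n m k))) ⟩
    Σ< m g + 0ℤ
      ≡⟨ ℤ.+-identityʳ _ ⟩
    Σ< m g                                            ∎

  Σ<-point : ∀ n j (g : ℕ → ℤ) → j < n → (∀ k → k < n → k ≢ j → g k ≡ 0ℤ) → Σ< n g ≡ g j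
  Σ<-point (suc n) zero g _ vanish = trans
    (cong (_+_ (g 0)) (Σ<-zero n (g ∘ suc) (λ k k<n → vanish (suc k) (s≤s k<n) (λ ())))) (ℤ.+-identityʳ _)
  Σ<-point (suc n) (suc j) g (s≤s j<n) vanish = trans
    (cong₂ _+_ (vanish 0 (s≤s z≤n) (λ ())) (Σ<-point n j (g ∘ suc) j<n (λ k k<n k≢j → vanish (suc k) (s≤s k<n) (k≢j ∘ ℕ.suc-injective))))
    (ℤ.+-identityˡ _)

  -- Σ_{d ∣ m} g d, where the candidate divisors d = k + 1 range over 1 … m.
  Σ∣ : ℕ → (ℕ → ℤ) → ℤ
  Σ∣ m g = Σ< m (λ k → ι (suc k ∣? m) * g (suc k))

  -- Divisors of m ≥ 1 are at most m, so the range may be extended past m.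
  Σ∣-extend : ∀ m n (g : ℕ → ℤ) → 1 ≤ m → m ≤ n → Σ< n (λ k → ι (suc k ∣? m) * g (suc k)) ≡ Σ∣ m g
  Σ∣-extend m n g m≥1 m≤n = Σ<-extend m n _ m≤n (λ k m≤k →
    cong (_* g (suc k)) (ι-no (suc k ∣? m) (λ k+1∣m → ℕ.<⇒≱ (s≤s m≤k) (∣⇒≤ {{ℕ.>-nonZero m≥1}} k+1∣m))))

module Mobius where
  open import Data.Nat as ℕ using (ℕ; zero; suc; z≤n; s≤s; _≤_; _<_)
  import Data.Nat.Properties as ℕ
  open import Data.Nat.Divisibility
  open import Data.Nat.DivMod using (_/_; n/n≡1; m/n≤m; m/n*n≡m; m≥n⇒m/n>0)
  open import Data.Nat.Primality using (Prime; prime?; euclidsLemma; prime⇒irreducible; prime⇒nonTrivial)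
  open import Data.Nat.Primality.Factorisation using (factorise)
  open import Data.Nat.Coprimality using (Coprime; coprime-divisor)
  open import Data.Nat.ListAction using (product)
  open import Data.Integer as ℤ using (ℤ; +_; 0ℤ; 1ℤ; -_; _+_; _*_)
  import Data.Integer.Properties as ℤ
  open import Data.Fin using (toℕ; fromℕ<)
  import Data.Fin.Properties as Fin
  open import Data.List using ([]; _∷_)
  open import Data.List.Relation.Unary.All using (_∷_)
  open import Data.Sum using (inj₁; inj₂; [_,_]′)
  open import Data.Product using (_,_; ∃; _×_)
  open import Data.Empty using (⊥-elim)
  open import Relation.Nullary using (Dec; yes; no; ¬_)
  open import Relation.Nullary.Decidable using (_×-dec_; ¬?)
  open import Relation.Binary.PropositionalEquality
  open import Function using (_∘_)
  open Counting using (χ; χ-⇔; χ-×)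
  open DivisorSums

  prime≥2 : ∀ {p} → Prime p → 2 ≤ p
  prime≥2 {p} pr = ℕ.nonTrivial⇒n>1 p {{prime⇒nonTrivial pr}}

  prime∤⇒coprime : ∀ {p a} → Prime p → ¬ p ∣ a → Coprime a p
  prime∤⇒coprime pr p∤a (d∣a , d∣p) with prime⇒irreducible pr d∣p
  ... | inj₁ d≡1 = d≡1
  ... | inj₂ refl = ⊥-elim (p∤a d∣a)

  prime-factor : ∀ m → 2 ≤ m → ∃ λ p → Prime p × p ∣ m
  prime-factor m@(suc _) m≥2 with factorise m
  ... | record { factors = [] ; isFactorisation = m≡1 } = ⊥-elim (ℕ.<⇒≢ m≥2 (sym m≡1))
  ... | record { factors = p ∷ ps ; isFactorisation = m≡p*ps ; factorsPrime = pr ∷ _ } =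
    p , pr , divides (product ps) (trans m≡p*ps (ℕ.*-comm p _))

  m≤pm : ∀ p m → 1 ≤ p → m ≤ p ℕ.* m
  m≤pm (suc p) m _ = ℕ.m≤m+n m (p ℕ.* m)

  μ-squarefree : ∀ d → SquareFree d → μ d ≡ (- 1ℤ) ℤ.^ numPrimeDivisors d
  μ-squarefree d sf with squareFree? d
  ... | yes _   = refl
  ... | no ¬sf = ⊥-elim (¬sf sf)

  μ-not-squarefree : ∀ d → ¬ SquareFree d → μ d ≡ 0ℤ
  μ-not-squarefree d ¬sf with squareFree? d
  ... | yes sf = ⊥-elim (¬sf sf)
  ... | no _   = refl

  squarefree⇒ : ∀ {d} → SquareFree d → ∀ m → 2 ≤ m → m ≤ d → ¬ (m ℕ.* m ∣ d)
  squarefree⇒ {d} sf m m≥2 m≤d = subst (λ t → ¬ (t ℕ.* t ∣ d)) (Fin.toℕ-fromℕ< (s≤s m≤d))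
    (sf (fromℕ< (s≤s m≤d)) (subst (2 ≤_) (sym (Fin.toℕ-fromℕ< (s≤s m≤d))) m≥2))

  ⇒squarefree : ∀ {d} → (∀ m → 2 ≤ m → m ≤ d → ¬ (m ℕ.* m ∣ d)) → SquareFree d
  ⇒squarefree no-square m m≥2 = no-square (toℕ m) m≥2 (ℕ.≤-pred (Fin.toℕ<n m))

  squarefree-∣ : ∀ p e → 1 ≤ p → SquareFree (p ℕ.* e) → SquareFree e
  squarefree-∣ p e p≥1 sf = ⇒squarefree λ m m≥2 m≤e m²∣e →
    squarefree⇒ sf m m≥2 (ℕ.≤-trans m≤e (m≤pm p e p≥1)) (∣-trans m²∣e (n∣m*n p))

  squarefree-* : ∀ p e → Prime p → ¬ p ∣ e → 1 ≤ e → SquareFree e → SquareFree (p ℕ.* e)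
  squarefree-* p e pr p∤e e≥1 sf = ⇒squarefree no-square
    where
    no-square : ∀ m → 2 ≤ m → m ≤ p ℕ.* e → ¬ (m ℕ.* m ∣ p ℕ.* e)
    no-square m m≥2 _ m²∣pe with p ∣? m
    ... | yes (divides t refl) = p∤e (*-cancelˡ-∣ p {{ℕ.>-nonZero (ℕ.≤-trans (s≤s z≤n) (prime≥2 pr))}}
            (∣-trans (divides (t ℕ.* t) (tp*tp≡t*t*pp t p)) m²∣pe))
      where
      tp*tp≡t*t*pp : ∀ t p → t ℕ.* p ℕ.* (t ℕ.* p) ≡ t ℕ.* t ℕ.* (p ℕ.* p)
      tp*tp≡t*t*pp = solve-∀ where open import Data.Nat.Tactic.RingSolver using (solve-∀)
    ... | no p∤m = squarefree⇒ sf m m≥2 (ℕ.≤-trans (m≤m*m m m≥2) (∣⇒≤ {{ℕ.>-nonZero e≥1}} m²∣e)) m²∣e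
      where
      m²∣e : m ℕ.* m ∣ e
      m²∣e = coprime-divisor (prime∤⇒coprime pr (λ p∣m² → [ p∤m , p∤m ]′ (euclidsLemma m m pr p∣m²))) m²∣pe
      m≤m*m : ∀ m → 2 ≤ m → m ≤ m ℕ.* m
      m≤m*m (suc m) _ = ℕ.m≤m*n (suc m) (suc m)

  +numPrimeDivisors : ∀ d → + numPrimeDivisors d ≡ Σ< (suc d) (λ k → ι (prime? k ×-dec k ∣? d))
  +numPrimeDivisors d = length-filter-upTo (λ k → prime? k ×-dec k ∣? d) (suc d) (λ k → k)

  numPrimeDivisors-* : ∀ p e → Prime p → ¬ p ∣ e → 1 ≤ e → numPrimeDivisors (p ℕ.* e) ≡ suc (numPrimeDivisors e)
  numPrimeDivisors-* p e pr p∤e e≥1 = ℤ.+-injective (begin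
    + numPrimeDivisors pe
      ≡⟨ +numPrimeDivisors pe ⟩
    Σ< (suc pe) (λ k → ι (prime? k ×-dec k ∣? pe))
      ≡⟨ Σ<-cong (suc pe) (λ k _ → split k) ⟩
    Σ< (suc pe) (λ k → ι (prime? k ×-dec k ∣? e) + ι (k ℕ.≟ p))
      ≡⟨ Σ<-+ (suc pe) (λ k → ι (prime? k ×-dec k ∣? e)) (λ k → ι (k ℕ.≟ p)) ⟩
    Σ< (suc pe) (λ k → ι (prime? k ×-dec k ∣? e)) + Σ< (suc pe) (λ k → ι (k ℕ.≟ p))
      ≡⟨ cong₂ _+_ old-primes new-prime ⟩
    + numPrimeDivisors e + 1ℤ
      ≡⟨ ℤ.+-comm (+ numPrimeDivisors e) 1ℤ ⟩
    + suc (numPrimeDivisors e)                                                ∎)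
    where
    open ≡-Reasoning
    pe = p ℕ.* e
    p≥1 = ℕ.≤-trans (s≤s z≤n) (prime≥2 pr)
    split : ∀ k → ι (prime? k ×-dec k ∣? pe) ≡ ι (prime? k ×-dec k ∣? e) + ι (k ℕ.≟ p)
    split k with prime? k | k ∣? e | k ℕ.≟ p
    ... | no _     | _       | no _     = refl
    ... | no ¬prime | _      | yes refl = ⊥-elim (¬prime pr)
    ... | yes _    | yes p∣e | yes refl = ⊥-elim (p∤e p∣e)
    ... | yes prₖ  | yes k∣e | no _     = ι-yes (yes prₖ ×-dec k ∣? pe) (prₖ , ∣-trans k∣e (n∣m*n p))
    ... | yes prₖ  | no _    | yes refl = ι-yes (yes prₖ ×-dec k ∣? pe) (prₖ , m∣m*n e)
    ... | yes prₖ  | no k∤e  | no k≢p   = ι-no (yes prₖ ×-dec k ∣? pe) λ (_ , k∣pe) → k∤pe k∣pe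
      where
      k∤pe : ¬ k ∣ pe
      k∤pe k∣pe with euclidsLemma p e prₖ k∣pe
      ... | inj₂ k∣e = k∤e k∣e
      ... | inj₁ k∣p with prime⇒irreducible pr k∣p
      ...   | inj₁ k≡1 = ℕ.<⇒≢ (prime≥2 prₖ) (sym k≡1)
      ...   | inj₂ k≡p = k≢p k≡p
    old-primes : Σ< (suc pe) (λ k → ι (prime? k ×-dec k ∣? e)) ≡ + numPrimeDivisors e
    old-primes = trans (Σ<-extend (suc e) (suc pe) _ (s≤s (m≤pm p e p≥1)) (λ k e<k →
        ι-no (prime? k ×-dec k ∣? e) (λ (_ , k∣e) → ℕ.<⇒≱ e<k (∣⇒≤ {{ℕ.>-nonZero e≥1}} k∣e))))
      (sym (+numPrimeDivisors e))
    new-prime : Σ< (suc pe) (λ k → ι (k ℕ.≟ p)) ≡ 1ℤ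
    new-prime = trans (Σ<-point (suc pe) p _ (s≤s (ℕ.≤-trans (ℕ.≤-reflexive (sym (ℕ.*-identityʳ p))) (ℕ.*-monoʳ-≤ p e≥1)))
        (λ k _ k≢p → ι-no (k ℕ.≟ p) k≢p)) (ι-yes (p ℕ.≟ p) refl)

  -- μ(p e) = 0 when p ∣ e, since then p² ∣ p e.
  μ-*-∣ : ∀ p e → 2 ≤ p → 1 ≤ e → p ∣ e → μ (p ℕ.* e) ≡ 0ℤ
  μ-*-∣ p e p≥2 e≥1 p∣e = μ-not-squarefree (p ℕ.* e) λ sf →
    squarefree⇒ sf p p≥2 (ℕ.≤-trans (ℕ.≤-reflexive (sym (ℕ.*-identityʳ p))) (ℕ.*-monoʳ-≤ p e≥1)) (*-monoʳ-∣ p p∣e)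

  μ-*-∤ : ∀ p e → Prime p → ¬ p ∣ e → 1 ≤ e → μ (p ℕ.* e) ≡ - μ e
  μ-*-∤ p e pr p∤e e≥1 = cases (squareFree? e)
    where
    open ≡-Reasoning
    cases : Dec (SquareFree e) → μ (p ℕ.* e) ≡ - μ e
    cases (yes sf) = begin
      μ (p ℕ.* e)                                  ≡⟨ μ-squarefree (p ℕ.* e) (squarefree-* p e pr p∤e e≥1 sf) ⟩
      (- 1ℤ) ℤ.^ numPrimeDivisors (p ℕ.* e)        ≡⟨ cong ((- 1ℤ) ℤ.^_) (numPrimeDivisors-* p e pr p∤e e≥1) ⟩
      - 1ℤ * (- 1ℤ) ℤ.^ numPrimeDivisors e         ≡⟨ ℤ.-1*i≡-i _ ⟩
      - ((- 1ℤ) ℤ.^ numPrimeDivisors e)            ≡⟨ cong -_ (sym (μ-squarefree e sf)) ⟩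
      - μ e                                        ∎
    cases (no ¬sf) = trans (μ-not-squarefree (p ℕ.* e) (¬sf ∘ squarefree-∣ p e (ℕ.≤-trans (s≤s z≤n) (prime≥2 pr))))
                           (cong -_ (sym (μ-not-squarefree e ¬sf)))

  μ-*-prime : ∀ p d → Prime p → 1 ≤ d → μ (p ℕ.* d) ≡ - (ι (¬? (p ∣? d)) * μ d)
  μ-*-prime p d pr d≥1 with p ∣? d
  ... | yes p∣d = trans (μ-*-∣ p d (prime≥2 pr) d≥1 p∣d) (sym (cong -_ (ℤ.*-zeroˡ (μ d))))
  ... | no p∤d  = trans (μ-*-∤ p d pr p∤d d≥1) (sym (cong -_ (ℤ.*-identityˡ (μ d))))

  multiples-reindex : ∀ p → 1 ≤ p → ∀ M (G : ℕ → ℤ) →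
    Σ< (M ℕ.* p) (λ k → ι (p ∣? suc k) * G (suc k)) ≡ Σ< M (λ j → G (p ℕ.* suc j))
  multiples-reindex p p≥1 zero G = refl
  multiples-reindex p@(suc p′) p≥1 (suc M) G = begin
    Σ< (p ℕ.+ M ℕ.* p) g
      ≡⟨ Σ<-split p (M ℕ.* p) g ⟩
    Σ< p g + Σ< (M ℕ.* p) (λ k → g (p ℕ.+ k))
      ≡⟨ cong₂ _+_ first-block (Σ<-cong (M ℕ.* p) (λ k _ → shift k)) ⟩
    G (p ℕ.* 1) + Σ< (M ℕ.* p) (λ k → ι (p ∣? suc k) * G (p ℕ.+ suc k))
      ≡⟨ cong (_+_ (G (p ℕ.* 1))) (multiples-reindex p p≥1 M (G ∘ (p ℕ.+_))) ⟩
    G (p ℕ.* 1) + Σ< M (λ j → G (p ℕ.+ p ℕ.* suc j))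
      ≡⟨ cong (_+_ (G (p ℕ.* 1))) (Σ<-cong M (λ j _ → cong G (sym (ℕ.*-suc p (suc j))))) ⟩
    Σ< (suc M) (λ j → G (p ℕ.* suc j))                       ∎
    where
    open ≡-Reasoning
    g : ℕ → ℤ
    g k = ι (p ∣? suc k) * G (suc k)
    -- among 1 … p only p itself is a multiple of p
    first-block : Σ< p g ≡ G (p ℕ.* 1)
    first-block = trans (Σ<-point p p′ g ℕ.≤-refl (λ k k<p k≢p′ → cong (_* G (suc k)) (ι-no (p ∣? suc k)
        (λ p∣k+1 → k≢p′ (ℕ.≤-antisym (ℕ.≤-pred k<p) (ℕ.≤-pred (∣⇒≤ p∣k+1)))))))
      (trans (cong (_* G p) (ι-yes (p ∣? p) ∣-refl)) (trans (ℤ.*-identityˡ _) (cong G (sym (ℕ.*-identityʳ p)))))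
    shift : ∀ k → g (p ℕ.+ k) ≡ ι (p ∣? suc k) * G (p ℕ.+ suc k)
    shift k = cong₂ _*_
      (cong +_ (χ-⇔ (p ∣? suc (p ℕ.+ k)) (p ∣? suc k)
        (λ p∣ → ∣m+n∣m⇒∣n (subst (p ∣_) (sym (ℕ.+-suc p k)) p∣) ∣-refl)
        (λ p∣ → subst (p ∣_) (ℕ.+-suc p k) (∣m∣n⇒∣m+n ∣-refl p∣))))
      (cong G (sym (ℕ.+-suc p k)))

  -- Σ_{d ∣ m} μ(d) = 0 for m ≥ 2: pick a prime p ∣ m, m = M p, and pair each
  -- divisor d of M with p ∤ d against p d, where μ(p d) = -μ(d).
  mobius-sum-vanishes : ∀ m → 2 ≤ m → Σ∣ m μ ≡ 0ℤ
  mobius-sum-vanishes m m≥2 with prime-factor m m≥2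
  ... | p , pr , divides M m≡Mp = begin
    Σ∣ m μ                                               ≡⟨ Σ<-cong m (λ k _ → split k) ⟩
    Σ< m (λ k → coprime-part k + multiple-part k)        ≡⟨ Σ<-+ m coprime-part multiple-part ⟩
    Σ< m coprime-part + Σ< m multiple-part               ≡⟨ cong₂ _+_ (Σ∣-extend M m h M≥1 M≤m) multiples ⟩
    Σ∣ M h + - Σ∣ M h                                    ≡⟨ ℤ.+-inverseʳ (Σ∣ M h) ⟩
    0ℤ                                                   ∎
    where
    open ≡-Reasoning
    p≥1 = ℕ.≤-trans (s≤s z≤n) (prime≥2 pr)
    m≡pM : m ≡ p ℕ.* M
    m≡pM = trans m≡Mp (ℕ.*-comm M p)
    M≥1 : 1 ≤ M
    M≥1 = ℕ.n≢0⇒n>0 λ { refl → ℕ.<⇒≢ (ℕ.≤-trans (s≤s z≤n) m≥2) (sym m≡Mp) }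
    M≤m : M ≤ m
    M≤m = subst (M ≤_) (sym m≡pM) (m≤pm p M p≥1)
    h : ℕ → ℤ
    h d = ι (¬? (p ∣? d)) * μ d
    G : ℕ → ℤ
    G d = ι (d ∣? m) * μ d
    coprime-part multiple-part : ℕ → ℤ
    coprime-part k = ι (suc k ∣? M) * h (suc k)
    multiple-part k = ι (p ∣? suc k) * G (suc k)
    -- a divisor d of m is either a multiple of p or a divisor of M prime to p
    split : ∀ k → ι (suc k ∣? m) * μ (suc k) ≡ coprime-part k + multiple-part k
    split k with p ∣? suc k
    ... | yes _  = sym (trans (cong (_+ (1ℤ * G (suc k))) (ℤ.*-zeroʳ (ι (suc k ∣? M))))
                              (trans (ℤ.+-identityˡ _) (ℤ.*-identityˡ _)))
    ... | no p∤d = begin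
      ι (suc k ∣? m) * μ (suc k)
        ≡⟨ cong (_* μ (suc k)) (cong +_ (χ-⇔ (suc k ∣? m) (suc k ∣? M) (to-M p∤d) to-m)) ⟩
      ι (suc k ∣? M) * μ (suc k)
        ≡⟨ cong (ι (suc k ∣? M) *_) (sym (ℤ.*-identityˡ (μ (suc k)))) ⟩
      ι (suc k ∣? M) * (1ℤ * μ (suc k))
        ≡⟨ sym (ℤ.+-identityʳ _) ⟩
      ι (suc k ∣? M) * (1ℤ * μ (suc k)) + 0ℤ
        ≡⟨ cong (_+_ (ι (suc k ∣? M) * (1ℤ * μ (suc k)))) (sym (ℤ.*-zeroˡ (G (suc k)))) ⟩
      ι (suc k ∣? M) * (1ℤ * μ (suc k)) + 0ℤ * G (suc k)
        ∎
      where
      to-M : ¬ p ∣ suc k → suc k ∣ m → suc k ∣ M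
      to-M p∤d d∣m = coprime-divisor (prime∤⇒coprime pr p∤d) (subst (suc k ∣_) m≡pM d∣m)
      to-m : suc k ∣ M → suc k ∣ m
      to-m d∣M = subst (suc k ∣_) (sym m≡Mp) (∣-trans d∣M (m∣m*n p))
    multiples : Σ< m multiple-part ≡ - Σ∣ M h
    multiples = begin
      Σ< m multiple-part                                  ≡⟨ cong (λ t → Σ< t multiple-part) m≡Mp ⟩
      Σ< (M ℕ.* p) multiple-part                          ≡⟨ multiples-reindex p p≥1 M G ⟩
      Σ< M (λ j → G (p ℕ.* suc j))                        ≡⟨ Σ<-cong M (λ j _ → G-multiple j) ⟩
      Σ< M (λ j → - (ι (suc j ∣? M) * h (suc j)))         ≡⟨ Σ<-neg M (λ j → ι (suc j ∣? M) * h (suc j)) ⟩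
      - Σ∣ M h                                            ∎
      where
      G-multiple : ∀ j → G (p ℕ.* suc j) ≡ - (ι (suc j ∣? M) * h (suc j))
      G-multiple j = begin
        ι (p ℕ.* suc j ∣? m) * μ (p ℕ.* suc j)        ≡⟨ cong₂ _*_ pd∣m⇔d∣M (μ-*-prime p (suc j) pr (s≤s z≤n)) ⟩
        ι (suc j ∣? M) * - h (suc j)                  ≡⟨ sym (ℤ.neg-distribʳ-* (ι (suc j ∣? M)) (h (suc j))) ⟩
        - (ι (suc j ∣? M) * h (suc j))                ∎
        where
        pd∣m⇔d∣M : ι (p ℕ.* suc j ∣? m) ≡ ι (suc j ∣? M)
        pd∣m⇔d∣M = cong +_ (χ-⇔ (p ℕ.* suc j ∣? m) (suc j ∣? M)
          (λ pd∣m → *-cancelˡ-∣ p {{ℕ.>-nonZero p≥1}} (subst (p ℕ.* suc j ∣_) m≡pM pd∣m))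
          (λ d∣M → subst (p ℕ.* suc j ∣_) (sym m≡pM) (*-monoʳ-∣ p d∣M)))

  mobius-sum : ∀ m → 1 ≤ m → Σ∣ m μ ≡ ι (m ℕ.≟ 1)
  mobius-sum (suc zero)    _ = refl
  mobius-sum (suc (suc m)) _ = mobius-sum-vanishes (suc (suc m)) (s≤s (s≤s z≤n))

  ι-guard : ∀ {p} {P : Set p} (d : Dec P) {x y : ℤ} → (P → x ≡ y) → ι d * x ≡ ι d * y
  ι-guard (yes p) x≡y = cong (_*_ 1ℤ) (x≡y p)
  ι-guard (no _)  _   = refl

  -- d ∣ r and e ∣ r / d together say d e ∣ r, which is symmetric in d and e.
  nested-divisors : ∀ d e r .{{_ : ℕ.NonZero d}} .{{_ : ℕ.NonZero e}} → d ∣ r × e ∣ r / d → e ∣ r × d ∣ r / e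
  nested-divisors d e r (d∣r , e∣r/d) = ∣-trans (m∣m*n d) ed∣r , m*n∣o⇒n∣o/m e d ed∣r
    where
    ed∣r : e ℕ.* d ∣ r
    ed∣r = subst (_∣ r) (ℕ.*-comm d e) (m∣n/o⇒o*m∣n d∣r e∣r/d)

  swap-divisors : ∀ r k j → ι (suc k ∣? r) * ι (suc j ∣? r / suc k) ≡ ι (suc j ∣? r) * ι (suc k ∣? r / suc j)
  swap-divisors r k j = begin
    ι k∣r * ι j∣r/k             ≡⟨ sym (ℤ.pos-* (χ k∣r) (χ j∣r/k)) ⟩
    + (χ k∣r ℕ.* χ j∣r/k)       ≡⟨ cong +_ (trans (χ-× k∣r j∣r/k) (trans (χ-⇔ _ _ swap swap) (sym (χ-× j∣r k∣r/j)))) ⟩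
    + (χ j∣r ℕ.* χ k∣r/j)       ≡⟨ ℤ.pos-* (χ j∣r) (χ k∣r/j) ⟩
    ι j∣r * ι k∣r/j             ∎
    where
    open ≡-Reasoning
    k∣r = suc k ∣? r
    j∣r = suc j ∣? r
    k∣r/j = suc k ∣? r / suc j
    j∣r/k = suc j ∣? r / suc k
    swap : ∀ {d e} → suc d ∣ r × suc e ∣ r / suc d → suc e ∣ r × suc d ∣ r / suc e
    swap {d} {e} = nested-divisors (suc d) (suc e) r

  quotient≥1 : ∀ {d r} .{{_ : ℕ.NonZero d}} → 1 ≤ r → d ∣ r → 1 ≤ r / d
  quotient≥1 r≥1 d∣r = m≥n⇒m/n>0 (∣⇒≤ {{ℕ.>-nonZero r≥1}} d∣r)

  -- Expanding a, exchanging the two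
  -- sums and collapsing the inner one with Σ_{d ∣ r/e} μ(d) = [e = r].
  mobius-inversion : (a P : ℕ → ℤ) → (∀ m → 1 ≤ m → a m ≡ Σ∣ m P) →
    ∀ r → 1 ≤ r → Σ< r (λ k → ι (suc k ∣? r) * (μ (suc k) * a (r / suc k))) ≡ P r
  mobius-inversion a P a≡ΣP r@(suc r′) r≥1 = begin
    Σ< r (λ k → ι (suc k ∣? r) * (μ (suc k) * a (r / suc k)))
      ≡⟨ Σ<-cong r (λ k _ → expand k) ⟩
    Σ< r (λ k → Σ< r (λ j → X k j))
      ≡⟨ Σ<-comm r r X ⟩
    Σ< r (λ j → Σ< r (λ k → X k j))
      ≡⟨ Σ<-cong r (λ j _ → collapse j) ⟩
    Σ< r (λ j → ι (suc j ∣? r) * (P (suc j) * ι (r / suc j ℕ.≟ 1)))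
      ≡⟨ Σ<-point r r′ _ ℕ.≤-refl other-terms ⟩
    ι (r ∣? r) * (P r * ι (r / r ℕ.≟ 1))
      ≡⟨ cong₂ (λ s t → s * (P r * t)) (ι-yes (r ∣? r) ∣-refl) (ι-yes (r / r ℕ.≟ 1) (n/n≡1 r)) ⟩
    1ℤ * (P r * 1ℤ)
      ≡⟨ trans (ℤ.*-identityˡ _) (ℤ.*-identityʳ _) ⟩
    P r                                                       ∎
    where
    open ≡-Reasoning
    open import Data.Integer.Tactic.RingSolver using (solve-∀)
    X : ℕ → ℕ → ℤ
    X k j = (ι (suc k ∣? r) * ι (suc j ∣? r / suc k)) * (μ (suc k) * P (suc j))
    expand : ∀ k → ι (suc k ∣? r) * (μ (suc k) * a (r / suc k)) ≡ Σ< r (λ j → X k j)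
    expand k = begin
      ι (suc k ∣? r) * (μ (suc k) * a (r / suc k))
        ≡⟨ ι-guard (suc k ∣? r) (λ k+1∣r → cong (μ (suc k) *_) (expand-a k+1∣r)) ⟩
      ι (suc k ∣? r) * (μ (suc k) * Σ< r g)
        ≡⟨ cong (ι (suc k ∣? r) *_) (sym (Σ<-*ˡ r (μ (suc k)) g)) ⟩
      ι (suc k ∣? r) * Σ< r (λ j → μ (suc k) * g j)
        ≡⟨ sym (Σ<-*ˡ r (ι (suc k ∣? r)) (λ j → μ (suc k) * g j)) ⟩
      Σ< r (λ j → ι (suc k ∣? r) * (μ (suc k) * g j))
        ≡⟨ Σ<-cong r (λ j _ → regroup (ι (suc k ∣? r)) (μ (suc k)) (ι (suc j ∣? r / suc k)) (P (suc j))) ⟩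
      Σ< r (λ j → X k j)                                                      ∎
      where
      g : ℕ → ℤ
      g j = ι (suc j ∣? r / suc k) * P (suc j)
      expand-a : suc k ∣ r → a (r / suc k) ≡ Σ< r g
      expand-a k+1∣r = trans (a≡ΣP (r / suc k) (quotient≥1 r≥1 k+1∣r))
        (sym (Σ∣-extend (r / suc k) r P (quotient≥1 r≥1 k+1∣r) (m/n≤m r (suc k))))
      regroup : ∀ (c m i p : ℤ) → c * (m * (i * p)) ≡ (c * i) * (m * p)
      regroup = solve-∀
    collapse : ∀ j → Σ< r (λ k → X k j) ≡ ι (suc j ∣? r) * (P (suc j) * ι (r / suc j ℕ.≟ 1))
    collapse j = begin
      Σ< r (λ k → X k j)
        ≡⟨ Σ<-cong r (λ k _ → swap k) ⟩
      Σ< r (λ k → ι (suc j ∣? r) * (P (suc j) * h k))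
        ≡⟨ Σ<-*ˡ r (ι (suc j ∣? r)) (λ k → P (suc j) * h k) ⟩
      ι (suc j ∣? r) * Σ< r (λ k → P (suc j) * h k)
        ≡⟨ cong (ι (suc j ∣? r) *_) (Σ<-*ˡ r (P (suc j)) h) ⟩
      ι (suc j ∣? r) * (P (suc j) * Σ< r h)
        ≡⟨ ι-guard (suc j ∣? r) (λ j+1∣r → cong (P (suc j) *_) (inner j+1∣r)) ⟩
      ι (suc j ∣? r) * (P (suc j) * ι (r / suc j ℕ.≟ 1))                      ∎
      where
      h : ℕ → ℤ
      h k = ι (suc k ∣? r / suc j) * μ (suc k)
      swap : ∀ k → X k j ≡ ι (suc j ∣? r) * (P (suc j) * h k)
      swap k = trans (cong (_* (μ (suc k) * P (suc j))) (swap-divisors r k j))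
        (regroup (ι (suc j ∣? r)) (ι (suc k ∣? r / suc j)) (μ (suc k)) (P (suc j)))
        where
        regroup : ∀ (c i m p : ℤ) → (c * i) * (m * p) ≡ c * (p * (i * m))
        regroup = solve-∀
      inner : suc j ∣ r → Σ< r h ≡ ι (r / suc j ℕ.≟ 1)
      inner j+1∣r = trans (Σ∣-extend (r / suc j) r μ (quotient≥1 r≥1 j+1∣r) (m/n≤m r (suc j)))
        (mobius-sum (r / suc j) (quotient≥1 r≥1 j+1∣r))
    other-terms : ∀ j → j < r → j ≢ r′ → ι (suc j ∣? r) * (P (suc j) * ι (r / suc j ℕ.≟ 1)) ≡ 0ℤ
    other-terms j _ j≢r′ = trans (ι-guard (suc j ∣? r) (λ j+1∣r →
        trans (cong (P (suc j) *_) (ι-no (r / suc j ℕ.≟ 1) (λ r/d≡1 → j≢r′ (ℕ.suc-injective (quotient-one j+1∣r r/d≡1)))))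
              (ℤ.*-zeroʳ (P (suc j)))))
      (ℤ.*-zeroʳ (ι (suc j ∣? r)))
      where
      quotient-one : ∀ {d} .{{_ : ℕ.NonZero d}} → d ∣ r → r / d ≡ 1 → d ≡ r
      quotient-one {d} d∣r r/d≡1 = trans (sym (ℕ.*-identityˡ d)) (trans (cong (ℕ._* d) (sym r/d≡1)) (m/n*n≡m d∣r))

module PowerMapPeriodicPoints {q : ℕ} (F : FiniteField q) (n : ℕ) (n≥2 : 2 ≤ n) where
  open import Data.Nat as ℕ using (ℕ; suc; _∸_; _≤_)
  import Data.Nat.Properties as ℕ
  open import Data.Nat.GCD using (gcd)
  open import Data.Nat.DivMod using (_/_)
  open import Data.Nat.Divisibility using (_∣?_)
  open import Data.Integer as ℤ using (ℤ; +_; _*_)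
  import Data.Integer.Properties as ℤ
  open import Data.Fin using (toℕ)
  open import Relation.Binary.PropositionalEquality
  open Counting using (χ; length-filter-allFin)
  open DivisorSums
  open Mobius using (mobius-inversion)
  open PowerMap F n using (power; fixed-points-count)
  open Periods power using (#periodic; fixed-points-decomposition)

  a : ℕ → ℤ
  a m = + (gcd (n ℕ.^ m ∸ 1) (q ∸ 1) ℕ.+ 1)

  fixed-points-divisor-sum : ∀ m → 1 ≤ m → a m ≡ Σ∣ m (λ d → + #periodic d)
  fixed-points-divisor-sum m m≥1 = begin
    a m
      ≡⟨ cong +_ (ℕ.+-comm _ 1) ⟩
    + suc (gcd (n ℕ.^ m ∸ 1) (q ∸ 1))
      ≡⟨ cong +_ (sym (fixed-points-count n≥2 m m≥1)) ⟩
    + Counting.count (λ x → iter power m x Fin.≟ x)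
      ≡⟨ cong +_ (fixed-points-decomposition m m≥1) ⟩
    + Counting.sum {m} (λ k → χ (suc (toℕ k) ∣? m) ℕ.* #periodic (suc (toℕ k)))
      ≡⟨ +-∑ m (λ k → χ (suc (toℕ k) ∣? m) ℕ.* #periodic (suc (toℕ k))) ⟩
    Σ< m (λ k → + (χ (suc k ∣? m) ℕ.* #periodic (suc k)))
      ≡⟨ Σ<-cong m (λ k _ → ℤ.pos-* (χ (suc k ∣? m)) (#periodic (suc k))) ⟩
    Σ∣ m (λ d → + #periodic d)                                            ∎
    where
    open ≡-Reasoning
    import Data.Fin.Properties as Fin

  periodic-points-formula : ∀ r → 1 ≤ r → + numPeriodicPoints power r ≡ periodicFormula n q r
  periodic-points-formula r r≥1 = begin
    + numPeriodicPoints power r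
      ≡⟨ cong +_ (length-filter-allFin (periodic? power r)) ⟩
    + #periodic r
      ≡⟨ sym (mobius-inversion a (λ d → + #periodic d) fixed-points-divisor-sum r r≥1) ⟩
    Σ< r (λ k → ι (suc k ∣? r) * (μ (suc k) * a (r / suc k)))
      ≡⟨ sym (foldr-filter-upTo (λ k → suc k ∣? r) (λ k → μ (suc k) * a (r / suc k)) r (λ k → k)) ⟩
    periodicFormula n q r                                            ∎
    where open ≡-Reasoning

open import Data.Nat using (_*_)
open import Data.Integer using (+_)
open import Data.Product using (_×_; _,_)
open import Relation.Binary.PropositionalEquality using (_≡_)

proposition2p5 : (q : ℕ) → IsPrimePower q → (F : FiniteField q) →
    (n : ℕ) → 2 ≤ n → (r : ℕ) → 1 ≤ r →
    (+ numPeriodicPoints (λ x → FiniteField._^_ F x n) r ≡ periodicFormula n q r)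
    × (r * numCycles (λ x → FiniteField._^_ F x n) r ≡ numPeriodicPoints (λ x → FiniteField._^_ F x n) r)
proposition2p5 q _ F n n≥2 r r≥1 =
  PowerMapPeriodicPoints.periodic-points-formula F n n≥2 r r≥1 ,
  Cycles.cycles-count (λ x → FiniteField._^_ F x n) r
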